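{- Let $b\ge2$ be an integer. There is a function $g\colon\omega\to\omega$ such that the following holds. Suppose $k_0<k_1<\cdots$ are integers with $b^{k_i}-b^{k_{i-1}}>g(i-1)$ for all $i\ge1$. Then Lebesgue-almost every $x\in(0,1)$ satisfies: for every integer $j\ge1$, every word $w\in\{0,\dots,b-1\}^j$ and every $\epsilon>0$, for all sufficiently large $i$ and every integer $n>g(i-1)$, $$\Big|\frac1n\,W\big(x\restriction[b^{k_{i-1}},b^{k_{i-1}}+n),w\big)-\frac1{b^j}\Big|<\epsilon.$$
   Context: Each $x\in(0,1)$ is identified with its base-$b$ expansion $x=\sum_{m\ge1}x_mb^{ -m}$, $x_m\in\{0,\dots,b-1\}$, with $x_m\neq0$ for infinitely many $m$. For an interval $A$ of reals, $x\restriction A$ is the word formed by the digits $x_m$ with $m$ a positive integer in $A$, in increasing order of $m$. $W(s,w)$ is the number of occurrences of the word $w$ in the word $s$ (all starting positions, overlaps allowed). -}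

module Defs where

open import Data.Nat using (ℕ; zero; suc; _+_; _*_; _∸_; _^_; _≤_; _<_; _≤?_)
open import Data.Nat.Properties using (m^n≢0)
open import Data.Fin using (Fin; _≟_)
open import Data.List using (List; []; _∷_; map; upTo; filter; length; tails)
open import Data.Bool using (Bool; true; false; _∧_)
open import Data.Integer using (+_)
open import Data.Rational using (ℚ; 0ℚ; _/_) renaming (_+_ to _+ℚ_)
open import Data.Product using (Σ; ∃; _×_)
open import Relation.Nullary using (¬_; does)
open import Relation.Binary.PropositionalEquality using (_≡_)

-- A point of (0,1) in base b: digit sequence, x m is the (m+1)-th digit x_{m+1}.
Digits : ℕ → Set
Digits b = ℕ → Fin b

-- the digit x_m for a positive integer m (1-indexed as in the paper)
digit : ∀ {b} → Digits b → ℕ → Fin b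
digit x m = x (m ∸ 1)

NonTerminating : ∀ {b} → Digits b → Set
NonTerminating {zero} x = ∀ m → Σ ℕ λ m' → m ≤ m'
NonTerminating {suc b} x = ∀ m → Σ ℕ λ m' → m ≤ m' × ¬ (x m' ≡ Fin.zero)

restrict : ∀ {b} → Digits b → ℕ → ℕ → List (Fin b)
restrict x a n = map (digit x) (filter (λ m → 1 ≤? m) (map (λ t → a + t) (upTo n)))

isPrefix : ∀ {b} → List (Fin b) → List (Fin b) → Bool
isPrefix [] s = true
isPrefix (c ∷ w) [] = false
isPrefix (c ∷ w) (d ∷ s) = does (c ≟ d) ∧ isPrefix w s

-- W(s,w): number of starting positions of occurrences of w in s (overlaps allowed)
W : ∀ {b} → List (Fin b) → List (Fin b) → ℕ
W s w = count (tails s)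
  where
  count : List (List _) → ℕ
  count [] = 0
  count (t ∷ ts) with isPrefix w t
  ... | true = suc (count ts)
  ... | false = count ts

-- the rational m / n (n > 0 in all uses; value 0 for n = 0)
frac : ℕ → ℕ → ℚ
frac m zero = 0ℚ
frac m (suc n) = (+ m) / suc n

-- b^(-L) as a rational (b > 0 in all uses)
recipPow : ℕ → ℕ → ℚ
recipPow zero L = 0ℚ
recipPow (suc b) L = (+ 1) / (suc b ^ L)
  where instance _ = m^n≢0 (suc b) L

InCyl : ∀ {b} → List (Fin b) → Digits b → Set
InCyl u x = restrict x 1 (length u) ≡ u

cylMass : ℕ → ℕ → ℚ
cylMass b L = recipPow b L

sumUpTo : (ℕ → ℚ) → ℕ → ℚ
sumUpTo f zero = 0ℚ
sumUpTo f (suc N) = sumUpTo f N +ℚ f N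

-- Lebesgue-almost every x (in base-b digit coordinates) satisfies P:
-- the set of x failing P is Lebesgue-null, i.e. for every ε > 0 it is covered
-- by countably many cylinders of total measure ≤ ε.  (Stated in the
-- constructively usable form: every x outside all cover cylinders satisfies P.)
AlmostEvery : (b : ℕ) → (Digits b → Set) → Set
AlmostEvery b P =
  (ε : ℚ) → Data.Rational._<_ 0ℚ ε →
  Σ (ℕ → List (Fin b)) λ c →
    ((N : ℕ) → Data.Rational._≤_ (sumUpTo (λ t → cylMass b (length (c t))) N) ε)
    × ((x : Digits b) → ((t : ℕ) → ¬ InCyl (c t) x) → P x)

-- Fix a word w of length j.  Summing over all b^n words s of length n, occurrences of w at
-- positions at least j apart are independent and at most 2jn pairs of positions are closer,
-- so ∑ₛ (b^j W(s,w) − n)² ≤ 3jn b^(j+n); by Chebyshev, at most a proportion 3jm²/(b^j n) of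
-- the s have a frequency of w at distance ≥ 1/m from b^(-j).  For the i-th block apply this to
-- every w of length ≤ i, with m = 2i, at the checkpoint lengths N_t = 96 i⁶ (t+1)²: the prefixes
-- of x whose block deviates there have measure ≤ 1/(2i(i+1)(t+1)(t+2)), and over all i ≥ M and
-- all t they have measure ≤ 1/M.  Off these cylinders, for N_t ≤ n < N_(t+1) with t ≥ 8(i+1),
-- the count W changes by at most j + (n − N_t) ≤ N_t/(4i) from N_t to n, so a frequency within
-- 1/(2i) of b^(-j) at N_t is within 1/i at n.

module Submission where

open import Defs

module _ where

  open import Data.Bool using (Bool; true; false; _∧_)
  open import Data.Empty using (⊥-elim)
  open import Data.Fin as Fin using (Fin; _≟_)
  open import Data.Integer as ℤ using ()
  import Data.Integer.Properties as ℤ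
  open import Data.List using (List; []; _∷_; [_]; _++_; map; concat; concatMap; length; upTo; applyUpTo; drop; filter; allFin; replicate)
  open import Data.List.Properties using (length-++; length-tabulate; length-upTo; length-applyUpTo; length-replicate; map-cong; map-cong-local; map-++; map-∘; map-tabulate; map-applyUpTo; drop-drop; filter-all; ++-assoc; ++-identityʳ)
  open import Data.List.Membership.Propositional using (_∈_)
  open import Data.List.Membership.Propositional.Properties using (∈-map⁺; ∈-map⁻; ∈-concat⁺′; ∈-concatMap⁻; ∈-allFin; ∈-upTo⁻; ∈-applyUpTo⁺; ∈-applyUpTo⁻; ∈-filter⁺; ∈-filter⁻; ∈-++⁺ʳ)
  import Data.List.Relation.Unary.All as All
  open import Data.List.Relation.Unary.All.Properties using (applyUpTo⁺₂)
  open import Data.List.Relation.Unary.Any using (here; there; satisfied)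
  open import Data.Nat using (ℕ; zero; suc; pred; _+_; _*_; _^_; _∸_; _≤_; _<_; _≤?_; _<?_; z≤n; s≤s; s≤s⁻¹; ∣_-_∣; NonZero; >-nonZero)
  open import Data.Nat.ListAction using (sum)
  open import Data.Nat.ListAction.Properties using (sum-++)
  open import Data.Nat.Properties hiding (_≟_)
  open import Algebra.Properties.CommutativeSemigroup +-commutativeSemigroup using () renaming (interchange to +-interchange)
  open import Algebra.Properties.CommutativeSemigroup *-commutativeSemigroup using () renaming (interchange to *-interchange)
  open import Data.Nat.Tactic.RingSolver using (solve-∀)
  open import Data.Product using (∃; _×_; _,_; proj₁)
  open import Data.Rational as ℚ using (ℚ; 0ℚ; mkℚ; toℚᵘ)
  import Data.Rational.Properties as ℚ
  open import Data.Rational.Unnormalised as ℚᵘ using (mkℚᵘ; *≤*; *<*; _≃_)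
  import Data.Rational.Unnormalised.Properties as ℚᵘ
  open import Data.Vec using (Vec; toList)
  open import Data.Vec.Properties using (length-toList)
  open import Function using (_∘_; _∘′_)
  open import Relation.Binary.PropositionalEquality using (_≡_; refl; sym; trans; cong; cong₂; subst; subst₂; module ≡-Reasoning)
  open import Relation.Nullary using (¬_; Dec; does; yes; no)
  open import Relation.Nullary.Decidable using (dec-true)
  open import Relation.Unary using (Decidable)

  -- Finite sums over lists

  𝟙 : Bool → ℕ
  𝟙 true = 1
  𝟙 false = 0

  𝟙≤1 : ∀ x → 𝟙 x ≤ 1
  𝟙≤1 true = ≤-refl
  𝟙≤1 false = z≤n

  ∑ : {A : Set} → List A → (A → ℕ) → ℕ
  ∑ xs f = sum (map f xs)

  syntax ∑ xs (λ x → e) = ∑[ x ∈ xs ] e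

  ∑-map : ∀ {A B : Set} (g : B → A) (xs : List B) f → ∑ (map g xs) f ≡ ∑ xs (f ∘ g)
  ∑-map g xs f = cong sum (sym (map-∘ xs))

  module _ {A : Set} where

    ∑-cong : ∀ (xs : List A) {f g : A → ℕ} → (∀ x → f x ≡ g x) → ∑ xs f ≡ ∑ xs g
    ∑-cong xs f≗g = cong sum (map-cong f≗g xs)

    ∑-cong-∈ : ∀ (xs : List A) {f g : A → ℕ} → (∀ {x} → x ∈ xs → f x ≡ g x) → ∑ xs f ≡ ∑ xs g
    ∑-cong-∈ xs f≗g = cong sum (map-cong-local (All.tabulate f≗g))

    ∑-mono-≤ : ∀ (xs : List A) {f g : A → ℕ} → (∀ {x} → x ∈ xs → f x ≤ g x) → ∑ xs f ≤ ∑ xs g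
    ∑-mono-≤ [] f≤g = z≤n
    ∑-mono-≤ (x ∷ xs) f≤g = +-mono-≤ (f≤g (here refl)) (∑-mono-≤ xs (f≤g ∘ there))

    ∑-+ : ∀ (xs : List A) (f g : A → ℕ) → ∑[ x ∈ xs ] (f x + g x) ≡ ∑ xs f + ∑ xs g
    ∑-+ [] f g = refl
    ∑-+ (x ∷ xs) f g = trans (cong (f x + g x +_) (∑-+ xs f g)) (+-interchange (f x) (g x) (∑ xs f) (∑ xs g))

    ∑-*ˡ : ∀ (xs : List A) c (f : A → ℕ) → ∑[ x ∈ xs ] (c * f x) ≡ c * ∑ xs f
    ∑-*ˡ [] c f = sym (*-zeroʳ c)
    ∑-*ˡ (x ∷ xs) c f = trans (cong (c * f x +_) (∑-*ˡ xs c f)) (sym (*-distribˡ-+ c (f x) _))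

    ∑-*ʳ : ∀ (xs : List A) (f : A → ℕ) c → ∑ xs f * c ≡ ∑[ x ∈ xs ] (f x * c)
    ∑-*ʳ xs f c = trans (*-comm (∑ xs f) c) (trans (sym (∑-*ˡ xs c f)) (∑-cong xs (λ x → *-comm c (f x))))

    ∑-const : ∀ (xs : List A) c → ∑[ x ∈ xs ] c ≡ length xs * c
    ∑-const [] c = refl
    ∑-const (x ∷ xs) c = cong (c +_) (∑-const xs c)

    ∑-zero : ∀ (xs : List A) {f : A → ℕ} → (∀ x → f x ≡ 0) → ∑ xs f ≡ 0
    ∑-zero xs f≡0 = trans (∑-cong xs f≡0) (trans (∑-const xs 0) (*-zeroʳ (length xs)))

    ∑-++ : ∀ (xs ys : List A) f → ∑ (xs ++ ys) f ≡ ∑ xs f + ∑ ys f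
    ∑-++ xs ys f = trans (cong sum (map-++ f xs ys)) (sum-++ (map f xs) (map f ys))

    ∑-concat : ∀ (xss : List (List A)) f → ∑ (concat xss) f ≡ ∑[ xs ∈ xss ] ∑ xs f
    ∑-concat [] f = refl
    ∑-concat (xs ∷ xss) f = trans (∑-++ xs (concat xss) f) (cong (∑ xs f +_) (∑-concat xss f))

    ∑-concatMap : ∀ {B : Set} (g : B → List A) (xs : List B) f → ∑ (concatMap g xs) f ≡ ∑[ x ∈ xs ] ∑ (g x) f
    ∑-concatMap g xs f = trans (∑-concat (map g xs) f) (∑-map g xs (λ ys → ∑ ys f))

  module _ {A B : Set} where

    ∑-swap : ∀ (xs : List A) (ys : List B) (f : A → B → ℕ) →
             ∑[ x ∈ xs ] ∑[ y ∈ ys ] f x y ≡ ∑[ y ∈ ys ] ∑[ x ∈ xs ] f x y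
    ∑-swap [] ys f = sym (∑-zero ys (λ _ → refl))
    ∑-swap (x ∷ xs) ys f = trans (cong (∑ ys (f x) +_) (∑-swap xs ys f)) (sym (∑-+ ys (f x) _))

    ∑-*-∑ : ∀ (xs : List A) (ys : List B) (f : A → ℕ) (g : B → ℕ) →
            ∑ xs f * ∑ ys g ≡ ∑[ x ∈ xs ] ∑[ y ∈ ys ] (f x * g y)
    ∑-*-∑ [] ys f g = refl
    ∑-*-∑ (x ∷ xs) ys f g = trans (*-distribʳ-+ (∑ ys g) (f x) (∑ xs f))
      (cong₂ _+_ (sym (∑-*ˡ ys (f x) g)) (∑-*-∑ xs ys f g))

  length-filter≡∑ : ∀ {A : Set} {P : A → Set} (P? : Decidable P) (xs : List A) → length (filter P? xs) ≡ ∑[ x ∈ xs ] 𝟙 (does (P? x))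
  length-filter≡∑ P? [] = refl
  length-filter≡∑ P? (x ∷ xs) with does (P? x)
  ... | true = cong suc (length-filter≡∑ P? xs)
  ... | false = length-filter≡∑ P? xs

  chebyshev : ∀ {A : Set} (xs : List A) (X : A → ℕ) T m →
              ∑[ x ∈ xs ] 𝟙 (does (T ≤? m * X x)) * (T * T) ≤ m * m * ∑[ x ∈ xs ] (X x * X x)
  chebyshev xs X T m = begin
    ∑[ x ∈ xs ] 𝟙 (does (T ≤? m * X x)) * (T * T)    ≡⟨ *-comm _ (T * T) ⟩
    T * T * ∑[ x ∈ xs ] 𝟙 (does (T ≤? m * X x))      ≡⟨ ∑-*ˡ xs (T * T) _ ⟨
    ∑[ x ∈ xs ] (T * T * 𝟙 (does (T ≤? m * X x)))    ≤⟨ ∑-mono-≤ xs (λ {x} _ → pointwise (T ≤? m * X x)) ⟩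
    ∑[ x ∈ xs ] (m * m * (X x * X x))                ≡⟨ ∑-*ˡ xs (m * m) _ ⟩
    m * m * ∑[ x ∈ xs ] (X x * X x)                  ∎
    where
    open ≤-Reasoning
    pointwise : ∀ {x} (T≤? : Dec (T ≤ m * X x)) → T * T * 𝟙 (does T≤?) ≤ m * m * (X x * X x)
    pointwise {x} (yes T≤mX) = begin
      T * T * 1                  ≡⟨ *-identityʳ (T * T) ⟩
      T * T                      ≤⟨ *-mono-≤ T≤mX T≤mX ⟩
      m * X x * (m * X x)        ≡⟨ *-interchange m (X x) m (X x) ⟩
      m * m * (X x * X x)        ∎
    pointwise (no _) = ≤-trans (≤-reflexive (*-zeroʳ (T * T))) z≤n

  ∈-concatMap-intro : ∀ {A B : Set} (f : A → List B) {x y xs} → x ∈ xs → y ∈ f x → y ∈ concatMap f xs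
  ∈-concatMap-intro f x∈xs y∈fx = ∈-concat⁺′ y∈fx (∈-map⁺ f x∈xs)

  length-concatMap : ∀ {A B : Set} (g : A → List B) (xs : List A) → length (concatMap g xs) ≡ ∑[ x ∈ xs ] length (g x)
  length-concatMap g [] = refl
  length-concatMap g (x ∷ xs) = trans (length-++ (g x)) (cong (length (g x) +_) (length-concatMap g xs))

  ∑∑-*ˡ : ∀ {A B : Set} (xs : List A) (ys : List B) c (f : A → B → ℕ) →
           ∑[ x ∈ xs ] ∑[ y ∈ ys ] (c * f x y) ≡ c * ∑[ x ∈ xs ] ∑[ y ∈ ys ] f x y
  ∑∑-*ˡ xs ys c f = trans (∑-cong xs (λ x → ∑-*ˡ ys c (f x))) (∑-*ˡ xs c (λ x → ∑[ y ∈ ys ] f x y))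

  ∑-upTo-suc : ∀ n (f : ℕ → ℕ) → ∑[ p ∈ upTo (suc n) ] f p ≡ f 0 + ∑[ p ∈ upTo n ] f (suc p)
  ∑-upTo-suc n f = cong (f 0 +_) (begin
    sum (map f (applyUpTo suc n))  ≡⟨ cong sum (map-applyUpTo suc f n) ⟩
    sum (applyUpTo (f ∘ suc) n)    ≡⟨ cong sum (map-applyUpTo (λ p → p) (f ∘ suc) n) ⟨
    ∑[ p ∈ upTo n ] f (suc p)      ∎)
    where open ≡-Reasoning

  count-below : ∀ n w → ∑[ q ∈ upTo n ] 𝟙 (does (q <? w)) ≤ w
  count-below zero w = z≤n
  count-below (suc n) zero = ≤-reflexive (trans (∑-upTo-suc n (λ q → 𝟙 (does (q <? 0)))) (∑-zero (upTo n) (λ _ → refl)))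
  count-below (suc n) (suc w) = ≤-trans (≤-reflexive (∑-upTo-suc n (λ q → 𝟙 (does (q <? suc w))))) (s≤s (count-below n w))

  count-interval : ∀ n lo w → ∑[ q ∈ upTo n ] 𝟙 (does (lo ≤? q) ∧ does (q <? lo + w)) ≤ w
  count-interval n zero w = count-below n w
  count-interval zero (suc lo) w = z≤n
  count-interval (suc n) (suc lo) w = begin
    ∑[ q ∈ upTo (suc n) ] 𝟙 (does (suc lo ≤? q) ∧ does (q <? suc lo + w))  ≡⟨ ∑-upTo-suc n (λ q → 𝟙 (does (suc lo ≤? q) ∧ does (q <? suc lo + w))) ⟩
    ∑[ q ∈ upTo n ] 𝟙 (does (suc lo ≤? suc q) ∧ does (q <? lo + w))        ≡⟨ ∑-cong (upTo n) (λ q → cong (λ c → 𝟙 (c ∧ does (q <? lo + w))) (≤ᵇ-suc lo q)) ⟩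
    ∑[ q ∈ upTo n ] 𝟙 (does (lo ≤? q) ∧ does (q <? lo + w))                ≤⟨ count-interval n lo w ⟩
    w                                                                      ∎
    where
    open ≤-Reasoning
    ≤ᵇ-suc : ∀ lo q → does (suc lo ≤? suc q) ≡ does (lo ≤? q)
    ≤ᵇ-suc zero q = refl
    ≤ᵇ-suc (suc lo) q = refl

  -- Sums over all words of a given length

  ∑-allFin-const : ∀ n x → ∑[ c ∈ allFin n ] x ≡ n * x
  ∑-allFin-const n x = trans (∑-const (allFin n) x) (cong (_* x) (length-tabulate {n = n} (λ c → c)))

  ∑-allFin-suc : ∀ n (f : Fin (suc n) → ℕ) → ∑ (allFin (suc n)) f ≡ f Fin.zero + ∑[ c ∈ allFin n ] f (Fin.suc c)
  ∑-allFin-suc n f = cong (f Fin.zero +_) (cong sum (trans (map-tabulate Fin.suc f) (sym (map-tabulate (λ c → c) (f ∘ Fin.suc)))))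

  ∑-allFin-single : ∀ {n} (d : Fin n) (f : Fin n → ℕ) → (∀ c → does (d ≟ c) ≡ false → f c ≡ 0) → ∑ (allFin n) f ≡ f d
  ∑-allFin-single {suc n} Fin.zero f vanish = begin
    ∑ (allFin (suc n)) f                ≡⟨ ∑-allFin-suc n f ⟩
    f Fin.zero + ∑[ c ∈ allFin n ] f (Fin.suc c) ≡⟨ cong (f Fin.zero +_) (∑-zero (allFin n) (λ c → vanish (Fin.suc c) refl)) ⟩
    f Fin.zero + 0                          ≡⟨ +-identityʳ (f Fin.zero) ⟩
    f Fin.zero                              ∎
    where open ≡-Reasoning
  ∑-allFin-single {suc n} (Fin.suc d) f vanish = begin
    ∑ (allFin (suc n)) f                ≡⟨ ∑-allFin-suc n f ⟩
    f Fin.zero + ∑[ c ∈ allFin n ] f (Fin.suc c) ≡⟨ cong (_+ ∑[ c ∈ allFin n ] f (Fin.suc c)) (vanish Fin.zero refl) ⟩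
    ∑[ c ∈ allFin n ] f (Fin.suc c)          ≡⟨ ∑-allFin-single d (f ∘ Fin.suc) (λ c → vanish (Fin.suc c)) ⟩
    f (Fin.suc d)                           ∎
    where open ≡-Reasoning

  module _ {b : ℕ} where

    words : ℕ → List (List (Fin b))
    words zero = [ [] ]
    words (suc n) = concatMap (λ c → map (c ∷_) (words n)) (allFin b)

    ∑-words-suc : ∀ n (f : List (Fin b) → ℕ) → ∑ (words (suc n)) f ≡ ∑[ c ∈ allFin b ] ∑[ s ∈ words n ] f (c ∷ s)
    ∑-words-suc n f = trans (∑-concatMap _ (allFin b) f) (∑-cong (allFin b) (λ c → ∑-map (c ∷_) (words n) f))

    ∑-words-const : ∀ n x → ∑[ s ∈ words n ] x ≡ b ^ n * x
    ∑-words-const zero x = refl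
    ∑-words-const (suc n) x = begin
      ∑[ s ∈ words (suc n) ] x          ≡⟨ ∑-words-suc n (λ _ → x) ⟩
      ∑[ c ∈ allFin b ] ∑[ s ∈ words n ] x ≡⟨ ∑-cong (allFin b) (λ _ → ∑-words-const n x) ⟩
      ∑[ c ∈ allFin b ] (b ^ n * x)     ≡⟨ ∑-allFin-const b (b ^ n * x) ⟩
      b * (b ^ n * x)                   ≡⟨ *-assoc b (b ^ n) x ⟨
      b ^ suc n * x                     ∎
      where open ≡-Reasoning

    words-length : ∀ {n s} → s ∈ words n → length s ≡ n
    words-length {zero} (here refl) = refl
    words-length {suc n} s∈ with satisfied (∈-concatMap⁻ (λ c → map (c ∷_) (words n)) {xs = allFin b} s∈)
    ... | c , s∈c∷ with ∈-map⁻ (c ∷_) s∈c∷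
    ... | s′ , s′∈ , refl = cong suc (words-length s′∈)

    ∈-words : ∀ s → s ∈ words (length s)
    ∈-words [] = here refl
    ∈-words (c ∷ s) = ∈-concatMap-intro (λ c → map (c ∷_) (words (length s))) (∈-allFin c) (∈-map⁺ (c ∷_) (∈-words s))

    ∑-words-drop : ∀ p m (f : List (Fin b) → ℕ) → ∑[ s ∈ words (p + m) ] f (drop p s) ≡ b ^ p * ∑ (words m) f
    ∑-words-drop zero m f = sym (+-identityʳ (∑ (words m) f))
    ∑-words-drop (suc p) m f = begin
      ∑[ s ∈ words (suc p + m) ] f (drop (suc p) s)        ≡⟨ ∑-words-suc (p + m) (f ∘ drop (suc p)) ⟩
      ∑[ c ∈ allFin b ] ∑[ s ∈ words (p + m) ] f (drop p s) ≡⟨ ∑-cong (allFin b) (λ _ → ∑-words-drop p m f) ⟩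
      ∑[ c ∈ allFin b ] (b ^ p * ∑ (words m) f)            ≡⟨ ∑-allFin-const b _ ⟩
      b * (b ^ p * ∑ (words m) f)                          ≡⟨ *-assoc b (b ^ p) _ ⟨
      b ^ suc p * ∑ (words m) f                            ∎
      where open ≡-Reasoning

    ∑-words-prefix : ∀ v m (f : List (Fin b) → ℕ) →
                     ∑[ s ∈ words (length v + m) ] (𝟙 (isPrefix v s) * f s) ≡ ∑[ s ∈ words m ] f (v ++ s)
    ∑-words-prefix [] m f = ∑-cong (words m) (λ s → +-identityʳ (f s))
    ∑-words-prefix (d ∷ v) m f = begin
      ∑[ s ∈ words (suc (length v + m)) ] (𝟙 (isPrefix (d ∷ v) s) * f s)
        ≡⟨ ∑-words-suc (length v + m) _ ⟩
      ∑[ c ∈ allFin b ] ∑[ s ∈ words n ] (𝟙 (does (d ≟ c) ∧ isPrefix v s) * f (c ∷ s))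
        ≡⟨ ∑-allFin-single d _ vanish ⟩
      ∑[ s ∈ words n ] (𝟙 (does (d ≟ d) ∧ isPrefix v s) * f (d ∷ s))
        ≡⟨ matching ⟩
      ∑[ s ∈ words n ] (𝟙 (isPrefix v s) * f (d ∷ s))
        ≡⟨ ∑-words-prefix v m (f ∘ (d ∷_)) ⟩
      ∑[ s ∈ words m ] f (d ∷ v ++ s) ∎
      where
      open ≡-Reasoning
      n = length v + m
      vanish : ∀ c → does (d ≟ c) ≡ false → ∑[ s ∈ words n ] (𝟙 (does (d ≟ c) ∧ isPrefix v s) * f (c ∷ s)) ≡ 0
      vanish c d≢c rewrite d≢c = ∑-zero (words n) (λ _ → refl)
      matching : ∑[ s ∈ words n ] (𝟙 (does (d ≟ d) ∧ isPrefix v s) * f (d ∷ s)) ≡ ∑[ s ∈ words n ] (𝟙 (isPrefix v s) * f (d ∷ s))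
      matching rewrite dec-true (d ≟ d) refl = refl

    ∑-words-prefix-count : ∀ v m → ∑[ s ∈ words (length v + m) ] 𝟙 (isPrefix v s) ≡ b ^ m
    ∑-words-prefix-count v m = begin
      ∑[ s ∈ words (length v + m) ] 𝟙 (isPrefix v s)     ≡⟨ ∑-cong (words (length v + m)) (λ s → *-identityʳ (𝟙 (isPrefix v s))) ⟨
      ∑[ s ∈ words (length v + m) ] (𝟙 (isPrefix v s) * 1) ≡⟨ ∑-words-prefix v m (λ _ → 1) ⟩
      ∑[ s ∈ words m ] 1                                 ≡⟨ ∑-words-const m 1 ⟩
      b ^ m * 1                                          ≡⟨ *-identityʳ (b ^ m) ⟩
      b ^ m                                              ∎
      where open ≡-Reasoning

    occ : List (Fin b) → List (Fin b) → ℕ → ℕ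
    occ w s p = 𝟙 (isPrefix w (drop p s))

    drop-length-++ : ∀ (u v : List (Fin b)) r → drop (length u + r) (u ++ v) ≡ drop r v
    drop-length-++ [] v r = refl
    drop-length-++ (c ∷ u) v r = drop-length-++ u v r

    module _ (w : List (Fin b)) where

      ∑-occ : ∀ p m → ∑[ s ∈ words (p + (length w + m)) ] occ w s p ≡ b ^ p * b ^ m
      ∑-occ p m = trans (∑-words-drop p (length w + m) (𝟙 ∘ isPrefix w)) (cong (b ^ p *_) (∑-words-prefix-count w m))

      ∑-occ-occ : ∀ p r m → let j = length w in
                  ∑[ s ∈ words (p + (j + (r + (j + m)))) ] (occ w s p * occ w s (p + (j + r))) ≡ b ^ p * (b ^ r * b ^ m)
      ∑-occ-occ p r m = begin
        ∑[ s ∈ words (p + (j + (r + (j + m)))) ] (occ w s p * occ w s (p + (j + r)))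
          ≡⟨ ∑-cong (words (p + (j + (r + (j + m))))) (λ s → cong (λ t → occ w s p * 𝟙 (isPrefix w t)) (sym (drop-drop p (j + r) s))) ⟩
        ∑[ s ∈ words (p + (j + (r + (j + m)))) ] g (drop p s)
          ≡⟨ ∑-words-drop p (j + (r + (j + m))) g ⟩
        b ^ p * ∑[ s ∈ words (j + (r + (j + m))) ] (𝟙 (isPrefix w s) * occ w s (j + r))
          ≡⟨ cong (b ^ p *_) (∑-words-prefix w (r + (j + m)) (λ s → occ w s (j + r))) ⟩
        b ^ p * ∑[ s ∈ words (r + (j + m)) ] occ w (w ++ s) (j + r)
          ≡⟨ cong (b ^ p *_) (∑-cong (words (r + (j + m))) (λ s → cong (𝟙 ∘ isPrefix w) (drop-length-++ w s r))) ⟩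
        b ^ p * ∑[ s ∈ words (r + (j + m)) ] occ w s r
          ≡⟨ cong (b ^ p *_) (∑-occ r m) ⟩
        b ^ p * (b ^ r * b ^ m) ∎
        where
        open ≡-Reasoning
        j = length w
        g : List (Fin b) → ℕ
        g t = 𝟙 (isPrefix w t) * occ w t (j + r)

  -- Occurrence counts: moments and Chebyshev's inequality

  module _ {b : ℕ} where

    W-[] : ∀ (w : List (Fin b)) → W [] w ≡ 𝟙 (isPrefix w [])
    W-[] w with isPrefix w []
    ... | true = refl
    ... | false = refl

    W-∷ : ∀ (w : List (Fin b)) c s → W (c ∷ s) w ≡ 𝟙 (isPrefix w (c ∷ s)) + W s w
    W-∷ w c s with isPrefix w (c ∷ s)
    ... | true = refl
    ... | false = refl

    isPrefix-length : ∀ (w s : List (Fin b)) → isPrefix w s ≡ true → length w ≤ length s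
    isPrefix-length [] s _ = z≤n
    isPrefix-length (c ∷ w) (d ∷ s) w≼s with does (c ≟ d)
    ... | true = s≤s (isPrefix-length w s w≼s)

    isPrefix-short : ∀ (w s : List (Fin b)) → length s < length w → isPrefix w s ≡ false
    isPrefix-short w s s<w with isPrefix w s in w≼s
    ... | true = ⊥-elim (<⇒≱ s<w (isPrefix-length w s w≼s))
    ... | false = refl

    W-short : ∀ (w s : List (Fin b)) → length s < length w → W s w ≡ 0
    W-short w [] s<w = trans (W-[] w) (cong 𝟙 (isPrefix-short w [] s<w))
    W-short w (c ∷ s) s<w = begin
      W (c ∷ s) w                          ≡⟨ W-∷ w c s ⟩
      𝟙 (isPrefix w (c ∷ s)) + W s w       ≡⟨ cong₂ _+_ (cong 𝟙 (isPrefix-short w (c ∷ s) s<w)) (W-short w s (<-trans (n<1+n _) s<w)) ⟩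
      0                                    ∎
      where open ≡-Reasoning

    W≡∑occ : ∀ (w : List (Fin b)) e s → length s ≡ length w + e → W s w ≡ ∑[ p ∈ upTo (suc e) ] occ w s p
    W≡∑occ w zero [] _ = trans (W-[] w) (sym (+-identityʳ _))
    W≡∑occ w zero (c ∷ s) ∣s∣≡ = begin
      W (c ∷ s) w                       ≡⟨ W-∷ w c s ⟩
      𝟙 (isPrefix w (c ∷ s)) + W s w    ≡⟨ cong (𝟙 (isPrefix w (c ∷ s)) +_) (W-short w s (≤-reflexive (trans ∣s∣≡ (+-identityʳ _)))) ⟩
      occ w (c ∷ s) 0 + 0               ∎
      where open ≡-Reasoning
    W≡∑occ w (suc e) [] ∣s∣≡ = ⊥-elim (m+1+n≢0 (length w) (sym ∣s∣≡))
    W≡∑occ w (suc e) (c ∷ s) ∣s∣≡ = begin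
      W (c ∷ s) w                                              ≡⟨ W-∷ w c s ⟩
      𝟙 (isPrefix w (c ∷ s)) + W s w                           ≡⟨ cong (𝟙 (isPrefix w (c ∷ s)) +_) (W≡∑occ w e s (suc-injective (trans ∣s∣≡ (+-suc _ e)))) ⟩
      occ w (c ∷ s) 0 + ∑[ p ∈ upTo (suc e) ] occ w s p        ≡⟨ ∑-upTo-suc (suc e) (occ w (c ∷ s)) ⟨
      ∑[ p ∈ upTo (suc (suc e)) ] occ w (c ∷ s) p              ∎
      where open ≡-Reasoning

  ∣m-n∣²+2mn≡m²+n² : ∀ m n → ∣ m - n ∣ * ∣ m - n ∣ + 2 * (m * n) ≡ m * m + n * n
  ∣m-n∣²+2mn≡m²+n² zero n = +-identityʳ (n * n)
  ∣m-n∣²+2mn≡m²+n² (suc m) zero = cong (suc m * suc m +_) (cong (2 *_) (*-zeroʳ (suc m)))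
  ∣m-n∣²+2mn≡m²+n² (suc m) (suc n) = begin
    ∣ m - n ∣ * ∣ m - n ∣ + 2 * (suc m * suc n)                    ≡⟨ expand (∣ m - n ∣ * ∣ m - n ∣) m n ⟩
    ∣ m - n ∣ * ∣ m - n ∣ + 2 * (m * n) + 2 * m + 2 * n + 2         ≡⟨ cong (λ x → x + 2 * m + 2 * n + 2) (∣m-n∣²+2mn≡m²+n² m n) ⟩
    m * m + n * n + 2 * m + 2 * n + 2                              ≡⟨ collect m n ⟩
    suc m * suc m + suc n * suc n                                  ∎
    where
    open ≡-Reasoning
    expand : ∀ x m n → x + 2 * (suc m * suc n) ≡ x + 2 * (m * n) + 2 * m + 2 * n + 2
    expand = solve-∀
    collect : ∀ m n → m * m + n * n + 2 * m + 2 * n + 2 ≡ suc m * suc m + suc n * suc n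
    collect = solve-∀

  module Moments {b : ℕ} (w : List (Fin b)) (e : ℕ) where

    j n : ℕ
    j = length w
    n = j + e

    positions : List ℕ
    positions = upTo (suc e)

    ∈-positions⁻ : ∀ {p} → p ∈ positions → p ≤ e
    ∈-positions⁻ p∈ = s≤s⁻¹ (∈-upTo⁻ p∈)

    E : ℕ → ℕ → ℕ
    E p q = ∑[ s ∈ words n ] (occ w s p * occ w s q)

    b^-+ : ∀ x y → b ^ (x + y) ≡ b ^ x * b ^ y
    b^-+ = ^-distribˡ-+-* b

    occ-mean : ∀ p → p ≤ e → b ^ j * ∑[ s ∈ words n ] occ w s p ≡ b ^ n
    occ-mean p p≤e = begin
      b ^ j * ∑[ s ∈ words n ] occ w s p              ≡⟨ cong (λ k → b ^ j * ∑[ s ∈ words k ] occ w s p) n≡ ⟩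
      b ^ j * ∑[ s ∈ words (p + (j + m)) ] occ w s p  ≡⟨ cong (b ^ j *_) (trans (∑-occ w p m) (sym (b^-+ p m))) ⟩
      b ^ j * b ^ (p + m)                             ≡⟨ trans (sym (b^-+ j (p + m))) (cong (λ k → b ^ (j + k)) (m+[n∸m]≡n p≤e)) ⟩
      b ^ n                                           ∎
      where
      open ≡-Reasoning
      m = e ∸ p
      n≡ : n ≡ p + (j + m)
      n≡ = trans (cong (j +_) (sym (m+[n∸m]≡n p≤e))) (x+[y+z]≡y+[x+z] j p m)
        where
        x+[y+z]≡y+[x+z] : ∀ x y z → x + (y + z) ≡ y + (x + z)
        x+[y+z]≡y+[x+z] = solve-∀

    E-comm : ∀ p q → E p q ≡ E q p
    E-comm p q = ∑-cong (words n) (λ s → *-comm (occ w s p) (occ w s q))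

    -- Occurrences at least j apart are independent.
    E-far : ∀ p q → p + j ≤ q → q ≤ e → b ^ j * (b ^ j * E p q) ≡ b ^ n
    E-far p q p+j≤q q≤e = begin
      b ^ j * (b ^ j * E p q)                             ≡⟨ cong (λ x → b ^ j * (b ^ j * x)) E≡ ⟩
      b ^ j * (b ^ j * (b ^ p * (b ^ r * b ^ m)))          ≡⟨ reorder (b ^ j) (b ^ p) (b ^ r) (b ^ m) ⟩
      b ^ p * (b ^ j * (b ^ r * (b ^ j * b ^ m)))          ≡⟨ powers ⟨
      b ^ (p + (j + (r + (j + m))))                       ≡⟨ cong (b ^_) n≡ ⟨
      b ^ n                                               ∎
      where
      open ≡-Reasoning
      r = q ∸ (p + j)
      m = e ∸ q
      q≡ : q ≡ p + (j + r)
      q≡ = trans (sym (m+[n∸m]≡n p+j≤q)) (+-assoc p j r)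
      n≡ : n ≡ p + (j + (r + (j + m)))
      n≡ = begin
        j + e                       ≡⟨ cong (j +_) (sym (m+[n∸m]≡n q≤e)) ⟩
        j + (q + m)                 ≡⟨ cong (λ x → j + (x + m)) q≡ ⟩
        j + (p + (j + r) + m)       ≡⟨ shuffle j p r m ⟩
        p + (j + (r + (j + m)))     ∎
        where
        shuffle : ∀ j p r m → j + (p + (j + r) + m) ≡ p + (j + (r + (j + m)))
        shuffle = solve-∀
      E≡ : E p q ≡ b ^ p * (b ^ r * b ^ m)
      E≡ = trans (cong₂ (λ k x → ∑[ s ∈ words k ] (occ w s p * occ w s x)) n≡ q≡) (∑-occ-occ w p r m)
      reorder : ∀ J P R M → J * (J * (P * (R * M))) ≡ P * (J * (R * (J * M)))
      reorder = solve-∀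
      powers : b ^ (p + (j + (r + (j + m)))) ≡ b ^ p * (b ^ j * (b ^ r * (b ^ j * b ^ m)))
      powers = trans (b^-+ p _) (cong (b ^ p *_) (trans (b^-+ j _) (cong (b ^ j *_) (trans (b^-+ r _) (cong (b ^ r *_) (b^-+ j m))))))

    E-near : ∀ p q → p ≤ e → b ^ j * E p q ≤ b ^ n
    E-near p q p≤e = ≤-trans (*-monoʳ-≤ (b ^ j) (∑-mono-≤ (words n) (λ {s} _ → occ-occ≤occ s))) (≤-reflexive (occ-mean p p≤e))
      where
      occ-occ≤occ : ∀ s → occ w s p * occ w s q ≤ occ w s p
      occ-occ≤occ s = ≤-trans (*-monoʳ-≤ (occ w s p) (𝟙≤1 _)) (≤-reflexive (*-identityʳ _))

    near : ℕ → ℕ → Bool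
    near p q = does (p ∸ j ≤? q) ∧ does (q <? p ∸ j + 2 * j)

    E-bound : ∀ p q → p ≤ e → q ≤ e → b ^ j * (b ^ j * E p q) ≤ b ^ n + 𝟙 (near p q) * (b ^ j * b ^ n)
    E-bound p q p≤e q≤e = bound (p ∸ j ≤? q) (q <? p ∸ j + 2 * j)
      where
      bound : (lo? : Dec (p ∸ j ≤ q)) (hi? : Dec (q < p ∸ j + 2 * j)) →
              b ^ j * (b ^ j * E p q) ≤ b ^ n + 𝟙 (does lo? ∧ does hi?) * (b ^ j * b ^ n)
      bound (yes _) (yes _) = begin
        b ^ j * (b ^ j * E p q)   ≤⟨ *-monoʳ-≤ (b ^ j) (E-near p q p≤e) ⟩
        b ^ j * b ^ n             ≤⟨ m≤n+m _ (b ^ n) ⟩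
        b ^ n + b ^ j * b ^ n     ≡⟨ cong (b ^ n +_) (*-identityˡ _) ⟨
        b ^ n + 1 * (b ^ j * b ^ n) ∎
        where open ≤-Reasoning
      bound (yes _) (no q≮hi) = ≤-trans (≤-reflexive (E-far p q p+j≤q q≤e)) (m≤m+n (b ^ n) 0)
        where
        p+j≤q : p + j ≤ q
        p+j≤q = begin
          p + j               ≤⟨ +-monoˡ-≤ j (m≤n+m∸n p j) ⟩
          j + (p ∸ j) + j     ≡⟨ shuffle j (p ∸ j) ⟩
          p ∸ j + 2 * j       ≤⟨ ≮⇒≥ q≮hi ⟩
          q                   ∎
          where
          open ≤-Reasoning
          shuffle : ∀ j x → j + x + j ≡ x + 2 * j
          shuffle = solve-∀
      bound (no q≱lo) _ = ≤-trans (≤-reflexive (trans (cong (λ x → b ^ j * (b ^ j * x)) (E-comm p q)) (E-far q p q+j≤p p≤e))) (m≤m+n (b ^ n) 0)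
        where
        q<lo : q < p ∸ j
        q<lo = ≰⇒> q≱lo
        j≤p : j ≤ p
        j≤p = <⇒≤ (m∸n≢0⇒n<m (λ p∸j≡0 → n≮0 (subst (q <_) p∸j≡0 q<lo)))
        q+j≤p : q + j ≤ p
        q+j≤p = ≤-trans (+-monoˡ-≤ j (<⇒≤ q<lo)) (≤-reflexive (m∸n+n≡m j≤p))

    W-as-∑ : ∀ {s} → s ∈ words n → W s w ≡ ∑[ p ∈ positions ] occ w s p
    W-as-∑ s∈ = W≡∑occ w e _ (words-length s∈)

    first-moment : b ^ j * ∑[ s ∈ words n ] W s w ≡ suc e * b ^ n
    first-moment = begin
      b ^ j * ∑[ s ∈ words n ] W s w                           ≡⟨ cong (b ^ j *_) (∑-cong-∈ (words n) W-as-∑) ⟩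
      b ^ j * ∑[ s ∈ words n ] ∑[ p ∈ positions ] occ w s p    ≡⟨ cong (b ^ j *_) (∑-swap (words n) positions (occ w)) ⟩
      b ^ j * ∑[ p ∈ positions ] ∑[ s ∈ words n ] occ w s p    ≡⟨ ∑-*ˡ positions (b ^ j) _ ⟨
      ∑[ p ∈ positions ] (b ^ j * ∑[ s ∈ words n ] occ w s p)  ≡⟨ ∑-cong-∈ positions (λ {p} p∈ → occ-mean p (∈-positions⁻ p∈)) ⟩
      ∑[ p ∈ positions ] (b ^ n)                               ≡⟨ trans (∑-const positions (b ^ n)) (cong (_* b ^ n) (length-upTo (suc e))) ⟩
      suc e * b ^ n                                            ∎
      where open ≡-Reasoning

    ∑W²≡∑E : ∑[ s ∈ words n ] (W s w * W s w) ≡ ∑[ p ∈ positions ] ∑[ q ∈ positions ] E p q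
    ∑W²≡∑E = begin
      ∑[ s ∈ words n ] (W s w * W s w)
        ≡⟨ ∑-cong-∈ (words n) (λ {s} s∈ → trans (cong₂ _*_ (W-as-∑ s∈) (W-as-∑ s∈)) (∑-*-∑ positions positions (occ w s) (occ w s))) ⟩
      ∑[ s ∈ words n ] ∑[ p ∈ positions ] ∑[ q ∈ positions ] (occ w s p * occ w s q)
        ≡⟨ ∑-swap (words n) positions _ ⟩
      ∑[ p ∈ positions ] ∑[ s ∈ words n ] ∑[ q ∈ positions ] (occ w s p * occ w s q)
        ≡⟨ ∑-cong positions (λ p → ∑-swap (words n) positions _) ⟩
      ∑[ p ∈ positions ] ∑[ q ∈ positions ] E p q ∎
      where open ≡-Reasoning

    second-moment : b ^ j * (b ^ j * ∑[ s ∈ words n ] (W s w * W s w)) ≤ suc e * (suc e * b ^ n + b ^ j * b ^ n * (2 * j))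
    second-moment = begin
      b ^ j * (b ^ j * ∑[ s ∈ words n ] (W s w * W s w))
        ≡⟨ cong (λ x → b ^ j * (b ^ j * x)) ∑W²≡∑E ⟩
      b ^ j * (b ^ j * ∑[ p ∈ positions ] ∑[ q ∈ positions ] E p q)
        ≡⟨ trans (∑∑-*ˡ positions positions (b ^ j) (λ p q → b ^ j * E p q)) (cong (b ^ j *_) (∑∑-*ˡ positions positions (b ^ j) E)) ⟨
      ∑[ p ∈ positions ] ∑[ q ∈ positions ] (b ^ j * (b ^ j * E p q))
        ≤⟨ ∑-mono-≤ positions (λ p∈ → ∑-mono-≤ positions (λ q∈ → E-bound _ _ (∈-positions⁻ p∈) (∈-positions⁻ q∈))) ⟩
      ∑[ p ∈ positions ] ∑[ q ∈ positions ] (b ^ n + 𝟙 (near p q) * K)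
        ≡⟨ ∑-cong positions split ⟩
      ∑[ p ∈ positions ] (suc e * b ^ n + K * ∑[ q ∈ positions ] 𝟙 (near p q))
        ≤⟨ ∑-mono-≤ positions (λ {p} _ → +-monoʳ-≤ (suc e * b ^ n) (*-monoʳ-≤ K (count-interval (suc e) (p ∸ j) (2 * j)))) ⟩
      ∑[ p ∈ positions ] (suc e * b ^ n + K * (2 * j))
        ≡⟨ trans (∑-const positions _) (cong (_* (suc e * b ^ n + K * (2 * j))) (length-upTo (suc e))) ⟩
      suc e * (suc e * b ^ n + K * (2 * j)) ∎
      where
      open ≤-Reasoning
      K = b ^ j * b ^ n
      split : ∀ p → ∑[ q ∈ positions ] (b ^ n + 𝟙 (near p q) * K) ≡ suc e * b ^ n + K * ∑[ q ∈ positions ] 𝟙 (near p q)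
      split p = trans (∑-+ positions (λ _ → b ^ n) (λ q → 𝟙 (near p q) * K)) (cong₂ _+_
        (trans (∑-const positions (b ^ n)) (cong (_* b ^ n) (length-upTo (suc e))))
        (trans (∑-cong positions (λ q → *-comm (𝟙 (near p q)) K)) (∑-*ˡ positions K _)))

    deviation : List (Fin b) → ℕ
    deviation s = ∣ b ^ j * W s w - n ∣

    variance-identity : ∑[ s ∈ words n ] (deviation s * deviation s) + 2 * n * b ^ j * ∑[ s ∈ words n ] W s w
                        ≡ b ^ j * (b ^ j * ∑[ s ∈ words n ] (W s w * W s w)) + b ^ n * (n * n)
    variance-identity = begin
      ∑[ s ∈ words n ] (deviation s * deviation s) + c * ∑[ s ∈ words n ] W s w
        ≡⟨ trans (∑-+ (words n) _ _) (cong (∑[ s ∈ words n ] (deviation s * deviation s) +_) (∑-*ˡ (words n) c (λ s → W s w))) ⟨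
      ∑[ s ∈ words n ] (deviation s * deviation s + c * W s w)
        ≡⟨ ∑-cong (words n) pointwise ⟩
      ∑[ s ∈ words n ] (b ^ j * (b ^ j * (W s w * W s w)) + n * n)
        ≡⟨ ∑-+ (words n) _ _ ⟩
      ∑[ s ∈ words n ] (b ^ j * (b ^ j * (W s w * W s w))) + ∑[ s ∈ words n ] (n * n)
        ≡⟨ cong₂ _+_ (trans (∑-*ˡ (words n) (b ^ j) _) (cong (b ^ j *_) (∑-*ˡ (words n) (b ^ j) _))) (∑-words-const n (n * n)) ⟩
      b ^ j * (b ^ j * ∑[ s ∈ words n ] (W s w * W s w)) + b ^ n * (n * n) ∎
      where
      open ≡-Reasoning
      c = 2 * n * b ^ j
      pointwise : ∀ s → deviation s * deviation s + c * W s w ≡ b ^ j * (b ^ j * (W s w * W s w)) + n * n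
      pointwise s = begin
        deviation s * deviation s + c * W s w                  ≡⟨ cong (deviation s * deviation s +_) (r₁ n (b ^ j) (W s w)) ⟩
        deviation s * deviation s + 2 * (b ^ j * W s w * n)    ≡⟨ ∣m-n∣²+2mn≡m²+n² (b ^ j * W s w) n ⟩
        b ^ j * W s w * (b ^ j * W s w) + n * n                ≡⟨ cong (_+ n * n) (r₂ (b ^ j) (W s w)) ⟩
        b ^ j * (b ^ j * (W s w * W s w)) + n * n              ∎
        where
        r₁ : ∀ n B x → 2 * n * B * x ≡ 2 * (B * x * n)
        r₁ = solve-∀
        r₂ : ∀ B x → B * x * (B * x) ≡ B * (B * (x * x))
        r₂ = solve-∀

    variance : .{{_ : NonZero b}} → 1 ≤ j → ∑[ s ∈ words n ] (deviation s * deviation s) ≤ 3 * j * n * (b ^ j * b ^ n)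
    variance 1≤j = variance-arith j e _ (b ^ n) (b ^ j) 1≤j (m≤n*m (b ^ n) (b ^ j) {{m^n≢0 b j}}) (begin
      A + 2 * n * (suc e * b ^ n)                          ≡⟨ cong (λ x → A + 2 * n * x) first-moment ⟨
      A + 2 * n * (b ^ j * ∑[ s ∈ words n ] W s w)         ≡⟨ cong (A +_) (*-assoc (2 * n) (b ^ j) _) ⟨
      A + 2 * n * b ^ j * ∑[ s ∈ words n ] W s w           ≡⟨ variance-identity ⟩
      b ^ j * (b ^ j * ∑[ s ∈ words n ] (W s w * W s w)) + b ^ n * (n * n)   ≤⟨ +-monoˡ-≤ _ second-moment ⟩
      suc e * (suc e * b ^ n + b ^ j * b ^ n * (2 * j)) + b ^ n * (n * n)     ∎)
      where
      open ≤-Reasoning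
      A = ∑[ s ∈ words n ] (deviation s * deviation s)
      variance-arith : ∀ j e A B C → 1 ≤ j → B ≤ C * B →
        A + 2 * (j + e) * (suc e * B) ≤ suc e * (suc e * B + C * B * (2 * j)) + B * ((j + e) * (j + e)) →
        A ≤ 3 * j * (j + e) * (C * B)
      variance-arith (suc j) e A B C _ B≤K h = begin
        A                                        ≤⟨ +-cancelˡ-≤ (2 * m * (P * B)) A _ (≤-trans (≤-reflexive (+-comm _ A)) (≤-trans h (≤-reflexive (regroup j e B C)))) ⟩
        j * j * B + 2 * suc j * P * K            ≤⟨ +-mono-≤ (*-mono-≤ (*-mono-≤ (n≤1+n j) (≤-trans (n≤1+n j) (m≤m+n (suc j) e))) B≤K)
                                                             (*-monoˡ-≤ K (*-monoʳ-≤ (2 * suc j) (s≤s (m≤n+m e j)))) ⟩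
        suc j * m * K + 2 * suc j * m * K        ≡⟨ collect (suc j) m K ⟩
        3 * suc j * m * K                        ∎
        where
        m = suc j + e
        P = suc e
        K = C * B
        regroup : ∀ j e B C → suc e * (suc e * B + C * B * (2 * suc j)) + B * ((suc j + e) * (suc j + e))
                              ≡ 2 * (suc j + e) * (suc e * B) + (j * j * B + 2 * suc j * suc e * (C * B))
        regroup = solve-∀
        collect : ∀ J n K → J * n * K + 2 * J * n * K ≡ 3 * J * n * K
        collect = solve-∀

  module _ {b : ℕ} where

    Deviates : ℕ → ℕ → List (Fin b) → List (Fin b) → Set
    Deviates m n w s = b ^ length w * n ≤ m * ∣ b ^ length w * W s w - n ∣

    deviates? : ∀ m n w → Decidable (Deviates m n w)
    deviates? m n w s = b ^ length w * n ≤? m * ∣ b ^ length w * W s w - n ∣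

    deviant-count : .{{_ : NonZero b}} → ∀ (w : List (Fin b)) m n → 1 ≤ length w → length w ≤ n →
                    length (filter (deviates? m n w) (words n)) * (b ^ length w * n) ≤ 3 * length w * (m * m) * b ^ n
    deviant-count w m n 1≤j j≤n with e , refl ← m≤n⇒∃[o]m+o≡n j≤n = *-cancelʳ-≤ _ _ T {{T≢0}} (begin
      length (filter (deviates? m n w) (words n)) * T * T       ≡⟨ trans (*-assoc (length (filter (deviates? m n w) (words n))) T T) (cong (_* (T * T)) (length-filter≡∑ (deviates? m n w) (words n))) ⟩
      ∑[ s ∈ words n ] 𝟙 (does (deviates? m n w s)) * (T * T)   ≤⟨ chebyshev (words n) deviation T m ⟩
      m * m * ∑[ s ∈ words n ] (deviation s * deviation s)     ≤⟨ *-monoʳ-≤ (m * m) (variance 1≤j) ⟩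
      m * m * (3 * j * n * (b ^ j * b ^ n))                    ≡⟨ reorder m j n (b ^ j) (b ^ n) ⟩
      3 * j * (m * m) * b ^ n * T                              ∎)
      where
      open Moments w e using (j; deviation; variance)
      open ≤-Reasoning
      T = b ^ j * n
      T≢0 : NonZero T
      T≢0 = m*n≢0 (b ^ j) n {{m^n≢0 b j}} {{>-nonZero (≤-trans 1≤j j≤n)}}
      reorder : ∀ m j n Bj Bn → m * m * (3 * j * n * (Bj * Bn)) ≡ 3 * j * (m * m) * Bn * (Bj * n)
      reorder = solve-∀

  -- Occurrences in a concatenation; digit segments

  applyUpTo-++ : ∀ {A : Set} (f : ℕ → A) m n → applyUpTo f (m + n) ≡ applyUpTo f m ++ applyUpTo (λ t → f (m + t)) n
  applyUpTo-++ f zero n = refl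
  applyUpTo-++ f (suc m) n = cong (f 0 ∷_) (applyUpTo-++ (λ t → f (suc t)) m n)

  drop-applyUpTo : ∀ {A : Set} (f : ℕ → A) m n → drop m (applyUpTo f (m + n)) ≡ applyUpTo (λ t → f (m + t)) n
  drop-applyUpTo f zero n = refl
  drop-applyUpTo f (suc m) n = drop-applyUpTo (λ t → f (suc t)) m n

  module _ {b : ℕ} where

    isPrefix-++ : ∀ (w t v : List (Fin b)) → isPrefix w t ≡ true → isPrefix w (t ++ v) ≡ true
    isPrefix-++ [] t v _ = refl
    isPrefix-++ (c ∷ w) (d ∷ t) v w≼t with does (c ≟ d)
    ... | true = isPrefix-++ w t v w≼t

    isPrefix-++-long : ∀ (w t v : List (Fin b)) → length w ≤ length t → isPrefix w (t ++ v) ≡ isPrefix w t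
    isPrefix-++-long [] t v _ = refl
    isPrefix-++-long (c ∷ w) (d ∷ t) v (s≤s w≤t) = cong (does (c ≟ d) ∧_) (isPrefix-++-long w t v w≤t)

    𝟙-isPrefix-++ : ∀ (w t v : List (Fin b)) → 𝟙 (isPrefix w t) ≤ 𝟙 (isPrefix w (t ++ v))
    𝟙-isPrefix-++ w t v with isPrefix w t in w≼t
    ... | true = ≤-reflexive (cong 𝟙 (sym (isPrefix-++ w t v w≼t)))
    ... | false = z≤n

    𝟙-isPrefix≤W : ∀ (w s : List (Fin b)) → 𝟙 (isPrefix w s) ≤ W s w
    𝟙-isPrefix≤W w [] = ≤-reflexive (sym (W-[] w))
    𝟙-isPrefix≤W w (c ∷ s) = ≤-trans (m≤m+n _ (W s w)) (≤-reflexive (sym (W-∷ w c s)))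

    W≤length : ∀ (w s : List (Fin b)) → 1 ≤ length w → W s w ≤ length s
    W≤length w [] 1≤j = ≤-reflexive (W-short w [] 1≤j)
    W≤length w (c ∷ s) 1≤j = ≤-trans (≤-reflexive (W-∷ w c s)) (+-mono-≤ (𝟙≤1 _) (W≤length w s 1≤j))

    W-++-≥ : ∀ (w u v : List (Fin b)) → W u w ≤ W (u ++ v) w
    W-++-≥ w [] v = ≤-trans (≤-reflexive (W-[] w)) (≤-trans (𝟙-isPrefix-++ w [] v) (𝟙-isPrefix≤W w v))
    W-++-≥ w (c ∷ u) v = begin
      W (c ∷ u) w                              ≡⟨ W-∷ w c u ⟩
      𝟙 (isPrefix w (c ∷ u)) + W u w           ≤⟨ +-mono-≤ (𝟙-isPrefix-++ w (c ∷ u) v) (W-++-≥ w u v) ⟩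
      𝟙 (isPrefix w (c ∷ u ++ v)) + W (u ++ v) w ≡⟨ W-∷ w c (u ++ v) ⟨
      W (c ∷ u ++ v) w                         ∎
      where open ≤-Reasoning

    W-++-≤ : ∀ (w u v : List (Fin b)) → 1 ≤ length w → W (u ++ v) w ≤ W u w + length w + length v
    W-++-≤ w [] v 1≤j = ≤-trans (W≤length w v 1≤j) (m≤n+m (length v) _)
    W-++-≤ w (c ∷ u) v 1≤j with length w ≤? length (c ∷ u)
    ... | yes j≤∣cu∣ = begin
      W (c ∷ u ++ v) w                                ≡⟨ W-∷ w c (u ++ v) ⟩
      𝟙 (isPrefix w (c ∷ u ++ v)) + W (u ++ v) w      ≡⟨ cong (λ x → 𝟙 x + W (u ++ v) w) (isPrefix-++-long w (c ∷ u) v j≤∣cu∣) ⟩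
      𝟙 (isPrefix w (c ∷ u)) + W (u ++ v) w           ≤⟨ +-monoʳ-≤ _ (W-++-≤ w u v 1≤j) ⟩
      𝟙 (isPrefix w (c ∷ u)) + (W u w + j + length v) ≡⟨ regroup (𝟙 (isPrefix w (c ∷ u))) (W u w) j (length v) ⟩
      𝟙 (isPrefix w (c ∷ u)) + W u w + j + length v   ≡⟨ cong (λ x → x + j + length v) (W-∷ w c u) ⟨
      W (c ∷ u) w + j + length v                      ∎
      where
      open ≤-Reasoning
      j = length w
      regroup : ∀ a x y z → a + (x + y + z) ≡ a + x + y + z
      regroup a x y z = trans (sym (+-assoc a (x + y) z)) (cong (_+ z) (sym (+-assoc a x y)))
    ... | no j≰∣cu∣ = begin
      W (c ∷ u ++ v) w                 ≤⟨ W≤length w (c ∷ u ++ v) 1≤j ⟩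
      length (c ∷ u ++ v)              ≡⟨ length-++ (c ∷ u) ⟩
      length (c ∷ u) + length v        ≤⟨ +-monoˡ-≤ (length v) (<⇒≤ (≰⇒> j≰∣cu∣)) ⟩
      length w + length v              ≤⟨ +-monoˡ-≤ (length v) (m≤n+m (length w) (W (c ∷ u) w)) ⟩
      W (c ∷ u) w + length w + length v ∎
      where open ≤-Reasoning

    -- segment x a n is x_{a+1} … x_{a+n} in the paper's 1-indexed notation.
    segment : Digits b → ℕ → ℕ → List (Fin b)
    segment x a n = applyUpTo (λ t → x (a + t)) n

    restrict-segment : ∀ (x : Digits b) a n → restrict x (suc a) n ≡ segment x a n
    restrict-segment x a n = begin
      map (digit x) (filter (1 ≤?_) (map (suc a +_) (upTo n)))   ≡⟨ cong (map (digit x) ∘′ filter (1 ≤?_)) (map-applyUpTo (λ t → t) (suc a +_) n) ⟩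
      map (digit x) (filter (1 ≤?_) (applyUpTo (suc a +_) n))    ≡⟨ cong (map (digit x)) (filter-all (1 ≤?_) (applyUpTo⁺₂ (suc a +_) n (λ _ → s≤s z≤n))) ⟩
      map (digit x) (applyUpTo (suc a +_) n)                     ≡⟨ map-applyUpTo (suc a +_) (digit x) n ⟩
      segment x a n                                              ∎
      where
      open ≡-Reasoning

  -- Fractions of natural numbers

  infixl 7 _÷_

  _÷_ : ℕ → (d : ℕ) → .{{NonZero d}} → ℚ
  a ÷ d = ℤ.+ a ℚ./ d

  private
    toℚᵘ-÷ : ∀ a d → toℚᵘ (a ÷ suc d) ≃ mkℚᵘ (ℤ.+ a) d
    toℚᵘ-÷ a d = ℚ.toℚᵘ-fromℚᵘ (mkℚᵘ (ℤ.+ a) d)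

  ÷-≤ : ∀ a c d e .{{_ : NonZero d}} .{{_ : NonZero e}} → a * e ≤ c * d → a ÷ d ℚ.≤ c ÷ e
  ÷-≤ a c (suc d) (suc e) ae≤cd = ℚ.toℚᵘ-cancel-≤
    (ℚᵘ.≤-respˡ-≃ (ℚᵘ.≃-sym (toℚᵘ-÷ a d)) (ℚᵘ.≤-respʳ-≃ (ℚᵘ.≃-sym (toℚᵘ-÷ c e))
      (*≤* (subst₂ ℤ._≤_ (ℤ.pos-* a (suc e)) (ℤ.pos-* c (suc d)) (ℤ.+≤+ ae≤cd)))))

  ÷-< : ∀ a c d e .{{_ : NonZero d}} .{{_ : NonZero e}} → a * e < c * d → a ÷ d ℚ.< c ÷ e
  ÷-< a c (suc d) (suc e) ae<cd = ℚ.toℚᵘ-cancel-<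
    (ℚᵘ.<-respˡ-≃ (ℚᵘ.≃-sym (toℚᵘ-÷ a d)) (ℚᵘ.<-respʳ-≃ (ℚᵘ.≃-sym (toℚᵘ-÷ c e))
      (*<* (subst₂ ℤ._<_ (ℤ.pos-* a (suc e)) (ℤ.pos-* c (suc d)) (ℤ.+<+ ae<cd)))))

  ÷-cong : ∀ a c d e .{{_ : NonZero d}} .{{_ : NonZero e}} → a * e ≡ c * d → a ÷ d ≡ c ÷ e
  ÷-cong a c d e ae≡cd = ℚ.≤-antisym (÷-≤ a c d e (≤-reflexive ae≡cd)) (÷-≤ c a e d (≤-reflexive (sym ae≡cd)))

  0≤÷ : ∀ a d .{{_ : NonZero d}} → 0ℚ ℚ.≤ a ÷ d
  0≤÷ a d = subst (ℚ._≤ a ÷ d) (÷-cong 0 0 d 1 refl) (÷-≤ 0 a d d z≤n)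

  ÷-+ : ∀ a c d e .{{_ : NonZero d}} .{{_ : NonZero e}} →
        a ÷ d ℚ.+ c ÷ e ≡ _÷_ (a * e + c * d) (d * e) {{m*n≢0 d e}}
  ÷-+ a c (suc d) (suc e) = ℚ.toℚᵘ-injective (begin
    toℚᵘ (a ÷ suc d ℚ.+ c ÷ suc e)                          ≈⟨ ℚ.toℚᵘ-homo-+ (a ÷ suc d) (c ÷ suc e) ⟩
    toℚᵘ (a ÷ suc d) ℚᵘ.+ toℚᵘ (c ÷ suc e)                  ≈⟨ ℚᵘ.+-cong (toℚᵘ-÷ a d) (toℚᵘ-÷ c e) ⟩
    mkℚᵘ (ℤ.+ a) d ℚᵘ.+ mkℚᵘ (ℤ.+ c) e                      ≡⟨ cong (λ z → mkℚᵘ z (e + d * suc e)) numerator ⟩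
    mkℚᵘ (ℤ.+ (a * suc e + c * suc d)) (e + d * suc e)      ≈⟨ toℚᵘ-÷ (a * suc e + c * suc d) (e + d * suc e) ⟨
    toℚᵘ ((a * suc e + c * suc d) ÷ (suc d * suc e))        ∎)
    where
    open import Relation.Binary.Reasoning.Setoid ℚᵘ.≃-setoid
    numerator : ℤ.+ a ℤ.* ℤ.+ suc e ℤ.+ ℤ.+ c ℤ.* ℤ.+ suc d ≡ ℤ.+ (a * suc e + c * suc d)
    numerator = trans (sym (cong₂ ℤ._+_ (ℤ.pos-* a (suc e)) (ℤ.pos-* c (suc d)))) (sym (ℤ.pos-+ (a * suc e) (c * suc d)))

  ∣÷-1÷∣ : ∀ a n D .{{_ : NonZero n}} .{{_ : NonZero D}} →
           ℚ.∣ a ÷ n ℚ.- 1 ÷ D ∣ ≡ _÷_ ∣ a * D - n ∣ (n * D) {{m*n≢0 n D}}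
  ∣÷-1÷∣ a (suc n) (suc D) = ℚ.toℚᵘ-injective (begin
    toℚᵘ ℚ.∣ p ℚ.- q ∣                                ≈⟨ ℚ.toℚᵘ-homo-∣-∣ (p ℚ.- q) ⟩
    ℚᵘ.∣ toℚᵘ (p ℚ.- q) ∣                             ≈⟨ ℚᵘ.∣-∣-cong (ℚ.toℚᵘ-homo-+ p (ℚ.- q)) ⟩
    ℚᵘ.∣ toℚᵘ p ℚᵘ.+ toℚᵘ (ℚ.- q) ∣                   ≈⟨ ℚᵘ.∣-∣-cong (ℚᵘ.+-cong (toℚᵘ-÷ a n) (ℚᵘ.≃-trans (ℚ.toℚᵘ-homo‿- q) (ℚᵘ.-‿cong (toℚᵘ-÷ 1 D)))) ⟩
    ℚᵘ.∣ mkℚᵘ (ℤ.+ a) n ℚᵘ.- mkℚᵘ (ℤ.+ 1) D ∣         ≡⟨ cong (λ z → mkℚᵘ (ℤ.+ z) (D + n * suc D)) numerator ⟩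
    mkℚᵘ (ℤ.+ ∣ a * suc D - suc n ∣) (D + n * suc D)  ≈⟨ toℚᵘ-÷ ∣ a * suc D - suc n ∣ (D + n * suc D) ⟨
    toℚᵘ (∣ a * suc D - suc n ∣ ÷ (suc n * suc D))    ∎)
    where
    open import Relation.Binary.Reasoning.Setoid ℚᵘ.≃-setoid
    p = a ÷ suc n
    q = 1 ÷ suc D
    ∣⊖∣≡∣-∣ : ∀ x y → ℤ.∣ x ℤ.⊖ y ∣ ≡ ∣ x - y ∣
    ∣⊖∣≡∣-∣ zero zero = refl
    ∣⊖∣≡∣-∣ zero (suc y) = refl
    ∣⊖∣≡∣-∣ (suc x) zero = refl
    ∣⊖∣≡∣-∣ (suc x) (suc y) = trans (cong ℤ.∣_∣ (ℤ.[1+m]⊖[1+n]≡m⊖n x y)) (∣⊖∣≡∣-∣ x y)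
    numerator : ℤ.∣ ℤ.+ a ℤ.* ℤ.+ suc D ℤ.+ ℤ.- (ℤ.+ 1) ℤ.* ℤ.+ suc n ∣ ≡ ∣ a * suc D - suc n ∣
    numerator = trans (cong ℤ.∣_∣ (trans (cong₂ ℤ._+_ (sym (ℤ.pos-* a (suc D))) (cong (λ z → ℤ.-[1+ z ]) (+-identityʳ n)))
                                         (ℤ.m-n≡m⊖n (a * suc D) (suc n))))
                      (∣⊖∣≡∣-∣ (a * suc D) (suc n))

  ∃1÷suc≤ : ∀ ε → 0ℚ ℚ.< ε → ∃ λ d → 1 ÷ suc d ℚ.≤ ε
  ∃1÷suc≤ (mkℚ (ℤ.+ suc k) d _) _ = d , ℚ.toℚᵘ-cancel-≤
    (ℚᵘ.≤-respˡ-≃ (ℚᵘ.≃-sym (toℚᵘ-÷ 1 d)) (*≤* (ℤ.+≤+ (*-monoˡ-≤ (suc d) (s≤s (z≤n {k}))))))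
  ∃1÷suc≤ (mkℚ (ℤ.+ zero) d _) (ℚ.*<* (ℤ.+<+ ()))
  ∃1÷suc≤ (mkℚ ℤ.-[1+ k ] d _) (ℚ.*<* ())

  -- Rational sums, telescoping, and enumerating a sequence of finite lists

  ∑ℚ : {A : Set} → List A → (A → ℚ) → ℚ
  ∑ℚ [] f = 0ℚ
  ∑ℚ (x ∷ xs) f = f x ℚ.+ ∑ℚ xs f

  module _ {A : Set} where

    ∑ℚ-++ : ∀ (xs ys : List A) f → ∑ℚ (xs ++ ys) f ≡ ∑ℚ xs f ℚ.+ ∑ℚ ys f
    ∑ℚ-++ [] ys f = sym (ℚ.+-identityˡ (∑ℚ ys f))
    ∑ℚ-++ (x ∷ xs) ys f = trans (cong (f x ℚ.+_) (∑ℚ-++ xs ys f)) (sym (ℚ.+-assoc (f x) _ _))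

    ∑ℚ-concatMap : ∀ {B : Set} (g : B → List A) (xs : List B) f → ∑ℚ (concatMap g xs) f ≡ ∑ℚ xs (λ x → ∑ℚ (g x) f)
    ∑ℚ-concatMap g [] f = refl
    ∑ℚ-concatMap g (x ∷ xs) f = trans (∑ℚ-++ (g x) (concatMap g xs) f) (cong (∑ℚ (g x) f ℚ.+_) (∑ℚ-concatMap g xs f))

    ∑ℚ-mono-≤ : ∀ (xs : List A) {f g : A → ℚ} → (∀ {x} → x ∈ xs → f x ℚ.≤ g x) → ∑ℚ xs f ℚ.≤ ∑ℚ xs g
    ∑ℚ-mono-≤ [] f≤g = ℚ.≤-refl
    ∑ℚ-mono-≤ (x ∷ xs) f≤g = ℚ.+-mono-≤ (f≤g (here refl)) (∑ℚ-mono-≤ xs (f≤g ∘ there))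

    ∑ℚ-cong-∈ : ∀ (xs : List A) {f g : A → ℚ} → (∀ {x} → x ∈ xs → f x ≡ g x) → ∑ℚ xs f ≡ ∑ℚ xs g
    ∑ℚ-cong-∈ xs f≡g = ℚ.≤-antisym (∑ℚ-mono-≤ xs (ℚ.≤-reflexive ∘ f≡g)) (∑ℚ-mono-≤ xs (ℚ.≤-reflexive ∘ sym ∘ f≡g))

    ∑ℚ-const : ∀ (xs : List A) d .{{_ : NonZero d}} → ∑ℚ xs (λ _ → 1 ÷ d) ≡ length xs ÷ d
    ∑ℚ-const [] d = ÷-cong 0 0 1 d refl
    ∑ℚ-const (x ∷ xs) d = begin
      1 ÷ d ℚ.+ ∑ℚ xs (λ _ → 1 ÷ d)          ≡⟨ cong (1 ÷ d ℚ.+_) (∑ℚ-const xs d) ⟩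
      1 ÷ d ℚ.+ length xs ÷ d                ≡⟨ ÷-+ 1 (length xs) d d ⟩
      _÷_ (1 * d + length xs * d) (d * d) {{m*n≢0 d d}} ≡⟨ ÷-cong (1 * d + length xs * d) (suc (length xs)) (d * d) d {{m*n≢0 d d}} (regroup d (length xs)) ⟩
      suc (length xs) ÷ d                    ∎
      where
      open ≡-Reasoning
      regroup : ∀ d k → (1 * d + k * d) * d ≡ suc k * (d * d)
      regroup = solve-∀

  sumUpTo-shift : ∀ (f : ℕ → ℚ) n → sumUpTo f (suc n) ≡ f 0 ℚ.+ sumUpTo (f ∘ suc) n
  sumUpTo-shift f zero = trans (ℚ.+-identityˡ (f 0)) (sym (ℚ.+-identityʳ (f 0)))
  sumUpTo-shift f (suc n) = trans (cong (ℚ._+ f (suc n)) (sumUpTo-shift f n)) (ℚ.+-assoc (f 0) _ _)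

  sumUpTo-cong : ∀ n {f g : ℕ → ℚ} → (∀ k → k < n → f k ≡ g k) → sumUpTo f n ≡ sumUpTo g n
  sumUpTo-cong zero f≡g = refl
  sumUpTo-cong (suc n) f≡g = cong₂ ℚ._+_ (sumUpTo-cong n (λ k k<n → f≡g k (m≤n⇒m≤1+n k<n))) (f≡g n ≤-refl)

  sumUpTo-mono-≤ : ∀ n {f g : ℕ → ℚ} → (∀ k → f k ℚ.≤ g k) → sumUpTo f n ℚ.≤ sumUpTo g n
  sumUpTo-mono-≤ zero f≤g = ℚ.≤-refl
  sumUpTo-mono-≤ (suc n) f≤g = ℚ.+-mono-≤ (sumUpTo-mono-≤ n f≤g) (f≤g n)

  sumUpTo-extend : ∀ m n (f : ℕ → ℚ) → (∀ k → 0ℚ ℚ.≤ f k) → sumUpTo f m ℚ.≤ sumUpTo f (m + n)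
  sumUpTo-extend m zero f f≥0 = ℚ.≤-reflexive (cong (sumUpTo f) (sym (+-identityʳ m)))
  sumUpTo-extend m (suc n) f f≥0 = begin
    sumUpTo f m                       ≤⟨ sumUpTo-extend m n f f≥0 ⟩
    sumUpTo f (m + n)                 ≡⟨ ℚ.+-identityʳ _ ⟨
    sumUpTo f (m + n) ℚ.+ 0ℚ          ≤⟨ ℚ.+-monoʳ-≤ (sumUpTo f (m + n)) (f≥0 (m + n)) ⟩
    sumUpTo f (suc (m + n))           ≡⟨ cong (sumUpTo f) (+-suc m n) ⟨
    sumUpTo f (m + suc n)             ∎
    where open ℚ.≤-Reasoning

  ∑ℚ-applyUpTo : ∀ {A : Set} (h : ℕ → A) K (f : A → ℚ) → ∑ℚ (applyUpTo h K) f ≡ sumUpTo (f ∘ h) K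
  ∑ℚ-applyUpTo h zero f = refl
  ∑ℚ-applyUpTo h (suc K) f = trans (cong (f (h 0) ℚ.+_) (∑ℚ-applyUpTo (h ∘ suc) K f)) (sym (sumUpTo-shift (f ∘ h) K))

  telescope : ∀ y a K → sumUpTo (λ r → 1 ÷ (suc y * (suc a + r) * suc (suc a + r))) K ≡ K ÷ (suc y * suc a * (suc a + K))
  telescope y a zero = ÷-cong 0 0 1 (suc y * suc a * (suc a + 0)) refl
  telescope y a (suc K) = begin
    sumUpTo f K ℚ.+ f K                                           ≡⟨ cong (ℚ._+ f K) (telescope y a K) ⟩
    K ÷ (Y * A * (A + K)) ℚ.+ 1 ÷ (Y * (A + K) * suc (A + K))     ≡⟨ ÷-+ K 1 (Y * A * (A + K)) (Y * (A + K) * suc (A + K)) ⟩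
    (K * (Y * (A + K) * suc (A + K)) + 1 * (Y * A * (A + K))) ÷ (Y * A * (A + K) * (Y * (A + K) * suc (A + K)))
      ≡⟨ ÷-cong (K * (Y * (A + K) * suc (A + K)) + 1 * (Y * A * (A + K))) (suc K) (Y * A * (A + K) * (Y * (A + K) * suc (A + K))) (Y * A * (A + suc K)) (identity y a K) ⟩
    suc K ÷ (Y * A * (A + suc K))                                 ∎
    where
    open ≡-Reasoning
    Y = suc y
    A = suc a
    f : ℕ → ℚ
    f r = 1 ÷ (Y * (A + r) * suc (A + r))
    identity : ∀ y a K → (K * (suc y * (suc a + K) * suc (suc a + K)) + 1 * (suc y * suc a * (suc a + K))) * (suc y * suc a * (suc a + suc K))
                         ≡ suc K * (suc y * suc a * (suc a + K) * (suc y * (suc a + K) * suc (suc a + K)))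
    identity = solve-∀

  telescope-≤ : ∀ y a K → sumUpTo (λ r → 1 ÷ (suc y * (suc a + r) * suc (suc a + r))) K ℚ.≤ 1 ÷ (suc y * suc a)
  telescope-≤ y a K = ℚ.≤-trans (ℚ.≤-reflexive (telescope y a K)) (÷-≤ K 1 _ _ (begin
    K * (suc y * suc a)                  ≤⟨ *-monoˡ-≤ (suc y * suc a) (m≤n+m K (suc a)) ⟩
    (suc a + K) * (suc y * suc a)        ≡⟨ reorder (suc a + K) (suc y * suc a) ⟩
    1 * (suc y * suc a * (suc a + K))    ∎))
    where
    open ≤-Reasoning
    reorder : ∀ x y → x * y ≡ 1 * (y * x)
    reorder = solve-∀

  module _ {A : Set} (d : A) where

    lookupOr : List A → ℕ → A
    lookupOr [] n = d
    lookupOr (x ∷ xs) zero = x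
    lookupOr (x ∷ xs) (suc n) = lookupOr xs n

    lookupOr-++ˡ : ∀ xs ys n → n < length xs → lookupOr (xs ++ ys) n ≡ lookupOr xs n
    lookupOr-++ˡ (x ∷ xs) ys zero _ = refl
    lookupOr-++ˡ (x ∷ xs) ys (suc n) (s≤s n<∣xs∣) = lookupOr-++ˡ xs ys n n<∣xs∣

    ∈⇒lookupOr : ∀ {x} xs → x ∈ xs → ∃ λ n → n < length xs × lookupOr xs n ≡ x
    ∈⇒lookupOr (y ∷ xs) (here refl) = 0 , s≤s z≤n , refl
    ∈⇒lookupOr (y ∷ xs) (there x∈xs) with n , n<∣xs∣ , eq ← ∈⇒lookupOr xs x∈xs = suc n , s≤s n<∣xs∣ , eq

    sumUpTo-lookupOr : ∀ xs (f : A → ℚ) → sumUpTo (f ∘ lookupOr xs) (length xs) ≡ ∑ℚ xs f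
    sumUpTo-lookupOr [] f = refl
    sumUpTo-lookupOr (x ∷ xs) f = trans (sumUpTo-shift (f ∘ lookupOr (x ∷ xs)) (length xs)) (cong (f x ℚ.+_) (sumUpTo-lookupOr xs f))

  module Enumeration {A : Set} (first : ℕ → A) (rest : ℕ → List A) where

    stage : ℕ → List A
    stage t = first t ∷ rest t

    stages : ℕ → List A
    stages zero = []
    stages (suc t) = stages t ++ stage t

    -- The n-th entry of stage 0 ++ stage 1 ++ ⋯: stages are nonempty, so stages (suc n) has more than n entries.
    enumerate : ℕ → A
    enumerate n = lookupOr (first 0) (stages (suc n)) n

    private
      lookup : List A → ℕ → A
      lookup = lookupOr (first 0)

    t≤length-stages : ∀ t → t ≤ length (stages t)
    t≤length-stages zero = z≤n
    t≤length-stages (suc t) = begin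
      suc t                                  ≡⟨ +-comm 1 t ⟩
      t + 1                                  ≤⟨ +-mono-≤ (t≤length-stages t) (s≤s z≤n) ⟩
      length (stages t) + length (stage t)   ≡⟨ length-++ (stages t) ⟨
      length (stages (suc t))                ∎
      where open ≤-Reasoning

    stages-++ : ∀ t u → ∃ λ R → stages (t + u) ≡ stages t ++ R
    stages-++ t zero = [] , trans (cong stages (+-identityʳ t)) (sym (++-identityʳ (stages t)))
    stages-++ t (suc u) with R , eq ← stages-++ t u =
      R ++ stage (t + u) , trans (cong stages (+-suc t u)) (trans (cong (_++ stage (t + u)) eq) (++-assoc (stages t) R _))

    lookup-stages : ∀ t u n → n < length (stages t) → lookup (stages (t + u)) n ≡ lookup (stages t) n
    lookup-stages t u n n<∣st∣ with R , eq ← stages-++ t u = trans (cong (λ xs → lookup xs n) eq) (lookupOr-++ˡ (first 0) (stages t) R n n<∣st∣)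

    enumerate-stages : ∀ n t → n < t → enumerate n ≡ lookup (stages t) n
    enumerate-stages n t n<t = trans (sym (lookup-stages (suc n) (t ∸ suc n) n (t≤length-stages (suc n))))
                                     (cong (λ u → lookup (stages u) n) (m+[n∸m]≡n n<t))

    enumerate-complete : ∀ {a} t → a ∈ stage t → ∃ λ n → enumerate n ≡ a
    enumerate-complete {a} t a∈ with n , n<∣st∣ , eq ← ∈⇒lookupOr (first 0) (stages (suc t)) (∈-++⁺ʳ (stages t) a∈) =
      n , trans (enumerate-stages n (suc t + suc n) (m≤n+m (suc n) (suc t))) (trans (lookup-stages (suc t) (suc n) n n<∣st∣) eq)

    sumUpTo-enumerate : ∀ (f : A → ℚ) → (∀ a → 0ℚ ℚ.≤ f a) → ∀ N → sumUpTo (f ∘ enumerate) N ℚ.≤ sumUpTo (λ t → ∑ℚ (stage t) f) N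
    sumUpTo-enumerate f f≥0 N = begin
      sumUpTo (f ∘ enumerate) N                         ≡⟨ sumUpTo-cong N (λ n n<N → cong f (enumerate-stages n N n<N)) ⟩
      sumUpTo (f ∘ lookup (stages N)) N                 ≤⟨ sumUpTo-extend N (length (stages N) ∸ N) _ (λ n → f≥0 _) ⟩
      sumUpTo (f ∘ lookup (stages N)) (N + (length (stages N) ∸ N)) ≡⟨ cong (sumUpTo _) (m+[n∸m]≡n (t≤length-stages N)) ⟩
      sumUpTo (f ∘ lookup (stages N)) (length (stages N)) ≡⟨ sumUpTo-lookupOr (first 0) (stages N) f ⟩
      ∑ℚ (stages N) f                                   ≡⟨ ∑ℚ-stages N ⟩
      sumUpTo (λ t → ∑ℚ (stage t) f) N                  ∎
      where
      open ℚ.≤-Reasoning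
      ∑ℚ-stages : ∀ N → ∑ℚ (stages N) f ≡ sumUpTo (λ t → ∑ℚ (stage t) f) N
      ∑ℚ-stages zero = refl
      ∑ℚ-stages (suc N) = trans (∑ℚ-++ (stages N) (stage N) f) (cong (ℚ._+ ∑ℚ (stage N) f) (∑ℚ-stages N))

  -- Interpolation between checkpoints

  n≤m^n : ∀ m → 2 ≤ m → ∀ n → n ≤ m ^ n
  n≤m^n m 2≤m zero = z≤n
  n≤m^n m 2≤m (suc n) = begin
    suc n          ≤⟨ s≤s (n≤m^n m 2≤m n) ⟩
    suc (m ^ n)    ≡⟨ +-comm 1 (m ^ n) ⟩
    m ^ n + 1      ≤⟨ +-monoʳ-≤ (m ^ n) (m^n>0 m {{>-nonZero (≤-trans (s≤s z≤n) 2≤m)}} n) ⟩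
    m ^ n + m ^ n  ≡⟨ cong (m ^ n +_) (+-identityʳ (m ^ n)) ⟨
    2 * m ^ n      ≤⟨ *-monoˡ-≤ (m ^ n) 2≤m ⟩
    m ^ suc n      ∎
    where open ≤-Reasoning

  ∣-∣-shift : ∀ x x′ y y′ D → x ≤ x′ → x′ ≤ x + D → y ≤ y′ → y′ ≤ y + D → ∣ x′ - y′ ∣ ≤ ∣ x - y ∣ + 2 * D
  ∣-∣-shift x x′ y y′ D x≤x′ x′≤x+D y≤y′ y′≤y+D = begin
    ∣ x′ - y′ ∣                        ≤⟨ ∣-∣-triangle x′ x y′ ⟩
    ∣ x′ - x ∣ + ∣ x - y′ ∣            ≤⟨ +-monoʳ-≤ ∣ x′ - x ∣ (∣-∣-triangle x y y′) ⟩
    ∣ x′ - x ∣ + (∣ x - y ∣ + ∣ y - y′ ∣) ≤⟨ +-mono-≤ (gap x≤x′ x′≤x+D) (+-monoʳ-≤ ∣ x - y ∣ (gap′ y≤y′ y′≤y+D)) ⟩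
    D + (∣ x - y ∣ + D)                ≡⟨ regroup D ∣ x - y ∣ ⟩
    ∣ x - y ∣ + 2 * D                  ∎
    where
    open ≤-Reasoning
    gap : ∀ {u v} → u ≤ v → v ≤ u + D → ∣ v - u ∣ ≤ D
    gap {u} {v} u≤v v≤u+D = ≤-trans (≤-reflexive (m≤n⇒∣n-m∣≡n∸m u≤v)) (m≤n+o⇒m∸n≤o v u v≤u+D)
    gap′ : ∀ {u v} → u ≤ v → v ≤ u + D → ∣ u - v ∣ ≤ D
    gap′ {u} {v} u≤v v≤u+D = ≤-trans (≤-reflexive (m≤n⇒∣m-n∣≡n∸m u≤v)) (m≤n+o⇒m∸n≤o v u v≤u+D)
    regroup : ∀ a b → a + (b + a) ≡ b + 2 * a
    regroup = solve-∀

  interpolation : ∀ B i N δ W₀ W₁ j → 1 ≤ B →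
                  2 * i * ∣ B * W₀ - N ∣ < B * N → W₀ ≤ W₁ → W₁ ≤ W₀ + j + δ → 4 * i * (j + δ) ≤ N →
                  i * ∣ B * W₁ - (N + δ) ∣ < B * (N + δ)
  interpolation B i N δ W₀ W₁ j 1≤B close₀ W₀≤W₁ W₁≤ slack = *-cancelˡ-< 2 _ _ (begin-strict
    2 * (i * ∣ B * W₁ - (N + δ) ∣)           ≤⟨ *-monoʳ-≤ 2 (*-monoʳ-≤ i shift) ⟩
    2 * (i * (∣ B * W₀ - N ∣ + 2 * D))        ≡⟨ expand i ∣ B * W₀ - N ∣ B (j + δ) ⟩
    2 * i * ∣ B * W₀ - N ∣ + B * (4 * i * (j + δ)) <⟨ +-monoˡ-< _ close₀ ⟩
    B * N + B * (4 * i * (j + δ))             ≤⟨ +-monoʳ-≤ (B * N) (*-monoʳ-≤ B slack) ⟩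
    B * N + B * N                             ≤⟨ +-mono-≤ (*-monoʳ-≤ B (m≤m+n N δ)) (*-monoʳ-≤ B (m≤m+n N δ)) ⟩
    B * (N + δ) + B * (N + δ)                 ≡⟨ cong (B * (N + δ) +_) (+-identityʳ _) ⟨
    2 * (B * (N + δ))                         ∎)
    where
    open ≤-Reasoning
    D = B * (j + δ)
    shift : ∣ B * W₁ - (N + δ) ∣ ≤ ∣ B * W₀ - N ∣ + 2 * D
    shift = ∣-∣-shift (B * W₀) (B * W₁) N (N + δ) D (*-monoʳ-≤ B W₀≤W₁)
      (≤-trans (*-monoʳ-≤ B W₁≤) (≤-reflexive (trans (cong (B *_) (+-assoc W₀ j δ)) (*-distribˡ-+ B W₀ (j + δ)))))
      (m≤m+n N δ) (+-monoʳ-≤ N (≤-trans (m≤n+m δ j) (≤-trans (≤-reflexive (sym (*-identityˡ (j + δ)))) (*-monoˡ-≤ (j + δ) 1≤B))))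
    expand : ∀ i d B s → 2 * (i * (d + 2 * (B * s))) ≡ 2 * i * d + B * (4 * i * s)
    expand = solve-∀

  bracket : ∀ (f : ℕ → ℕ) → (∀ t → t ≤ f t) → ∀ t₀ n → f t₀ ≤ n → ∃ λ t → t₀ ≤ t × f t ≤ n × n < f (suc t)
  bracket f t≤f t₀ n ft₀≤n = search (suc n) t₀ ≤-refl ft₀≤n (≤-trans (m≤n+m (suc n) t₀) (t≤f (t₀ + suc n)))
    where
    search : ∀ fuel t → t₀ ≤ t → f t ≤ n → n < f (t + fuel) → ∃ λ t′ → t₀ ≤ t′ × f t′ ≤ n × n < f (suc t′)
    search zero t _ ft≤n n<f = ⊥-elim (<⇒≱ (subst (λ u → n < f u) (+-identityʳ t) n<f) ft≤n)
    search (suc fuel) t t₀≤t ft≤n n<f with n <? f (suc t)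
    ... | yes n<fst = t , t₀≤t , ft≤n , n<fst
    ... | no n≮fst = search fuel (suc t) (m≤n⇒m≤1+n t₀≤t) (≮⇒≥ n≮fst) (subst (λ u → n < f u) (+-suc t fuel) n<f)

  -- Checkpoints and the null cover

  -- scale is what piece-weight needs, startIndex what checkpoint-gap needs.
  scale : ℕ → ℕ
  scale i = 96 * i ^ 6

  checkpoint : ℕ → ℕ → ℕ
  checkpoint i t = scale i * (suc t * suc t)

  startIndex : ℕ → ℕ
  startIndex i = 8 * suc i

  threshold : ℕ → ℕ
  threshold i = checkpoint i (startIndex i)

  i≤scale : ∀ i → i ≤ scale i
  i≤scale zero = z≤n
  i≤scale (suc i) = ≤-trans (m≤m*n (suc i) (suc i ^ 5) {{m^n≢0 (suc i) 5}}) (m≤n*m (suc i ^ 6) 96)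

  i≤checkpoint : ∀ i t → i ≤ checkpoint i t
  i≤checkpoint i t = ≤-trans (i≤scale i) (m≤m*n (scale i) (suc t * suc t))

  t≤checkpoint : ∀ i t → 1 ≤ i → t ≤ checkpoint i t
  t≤checkpoint i t 1≤i = ≤-trans (≤-trans (n≤1+n t) (m≤m*n (suc t) (suc t))) (m≤n*m (suc t * suc t) (scale i) {{>-nonZero (≤-trans 1≤i (i≤scale i))}})

  checkpoint-gap : ∀ i t j δ → startIndex i ≤ t → checkpoint i t + δ < checkpoint i (suc t) → j ≤ i → 4 * i * (j + δ) ≤ checkpoint i t
  checkpoint-gap i t j δ startIndex≤t within j≤i = begin
    4 * i * (j + δ)                          ≤⟨ *-monoʳ-≤ (4 * i) (+-mono-≤ (≤-trans j≤i (i≤scale i)) (<⇒≤ δ<)) ⟩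
    4 * i * (c + c * (2 * t + 3))            ≡⟨ regroup i c t ⟩
    c * (8 * i * suc (suc t))                ≤⟨ *-monoʳ-≤ c key ⟩
    c * (suc t * suc t)                      ∎
    where
    open ≤-Reasoning
    c = scale i
    δ< : δ < c * (2 * t + 3)
    δ< = +-cancelˡ-< (c * (suc t * suc t)) δ _ (≤-trans within (≤-reflexive (square-step c t)))
      where
      square-step : ∀ c t → c * (suc (suc t) * suc (suc t)) ≡ c * (suc t * suc t) + c * (2 * t + 3)
      square-step = solve-∀
    regroup : ∀ i c t → 4 * i * (c + c * (2 * t + 3)) ≡ c * (8 * i * suc (suc t))
    regroup = solve-∀
    key : 8 * i * suc (suc t) ≤ suc t * suc t
    key = begin
      8 * i * suc (suc t)          ≡⟨ split i t ⟩
      8 * i * suc t + 8 * i        ≤⟨ +-monoʳ-≤ (8 * i * suc t) (*-monoʳ-≤ 8 (≤-trans (n≤1+n i) (≤-trans (m≤n*m (suc i) 8) (m≤n⇒m≤1+n startIndex≤t)))) ⟩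
      8 * i * suc t + 8 * suc t    ≡⟨ join i t ⟩
      startIndex i * suc t              ≤⟨ *-monoˡ-≤ (suc t) (m≤n⇒m≤1+n startIndex≤t) ⟩
      suc t * suc t                ∎
      where
      split : ∀ i t → 8 * i * suc (suc t) ≡ 8 * i * suc t + 8 * i
      split = solve-∀
      join : ∀ i t → 8 * i * suc t + 8 * suc t ≡ 8 * suc i * suc t
      join = solve-∀

  piece-weight : ∀ i t → 1 ≤ i → 2 * (suc t * suc (suc t)) * i * suc i * (12 * i ^ 4) ≤ checkpoint i t
  piece-weight i t 1≤i = begin
    2 * (suc t * suc (suc t)) * i * suc i * (12 * i ^ 4)   ≡⟨ regroup i (i ^ 4) t ⟩
    24 * i ^ 5 * suc t * (suc i * suc (suc t))            ≤⟨ *-monoʳ-≤ (24 * i ^ 5 * suc t) (*-mono-≤ (1+n≤2n 1≤i) (1+n≤2n (s≤s z≤n))) ⟩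
    24 * i ^ 5 * suc t * (2 * i * (2 * suc t))            ≡⟨ collect i (i ^ 4) t ⟩
    checkpoint i t                                        ∎
    where
    open ≤-Reasoning
    1+n≤2n : ∀ {n} → 1 ≤ n → suc n ≤ 2 * n
    1+n≤2n {n} 1≤n = ≤-trans (≤-reflexive (+-comm 1 n)) (+-monoʳ-≤ n (≤-trans 1≤n (m≤m+n n 0)))
    regroup : ∀ i p t → 2 * (suc t * suc (suc t)) * i * suc i * (12 * p) ≡ 24 * (i * p) * suc t * (suc i * suc (suc t))
    regroup = solve-∀
    collect : ∀ i p t → 24 * (i * p) * suc t * (2 * i * (2 * suc t)) ≡ 96 * (i * (i * p)) * (suc t * suc t)
    collect = solve-∀

  close⇒frac : ∀ b₁ W n j m i → suc m ≤ i → i * ∣ suc b₁ ^ j * W - n ∣ < suc b₁ ^ j * n →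
               ℚ.∣ frac W n ℚ.- recipPow (suc b₁) j ∣ ℚ.< 1 ÷ suc m
  close⇒frac b₁ W zero j m i _ close = ⊥-elim (n≮0 (subst (i * ∣ suc b₁ ^ j * W - 0 ∣ <_) (*-zeroʳ (suc b₁ ^ j)) close))
  close⇒frac b₁ W (suc n) j m i m<i close =
    subst (ℚ._< 1 ÷ suc m) (sym (∣÷-1÷∣ W (suc n) B {{_}} {{B≢0}})) (÷-< ∣ W * B - suc n ∣ 1 (suc n * B) (suc m) {{1+n*B≢0}} gap)
    where
    B = suc b₁ ^ j
    B≢0 : NonZero B
    B≢0 = m^n≢0 (suc b₁) j
    1+n*B≢0 : NonZero (suc n * B)
    1+n*B≢0 = m*n≢0 (suc n) B {{_}} {{B≢0}}
    gap : ∣ W * B - suc n ∣ * suc m < 1 * (suc n * B)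
    gap = begin-strict
      ∣ W * B - suc n ∣ * suc m     ≤⟨ *-monoʳ-≤ ∣ W * B - suc n ∣ m<i ⟩
      ∣ W * B - suc n ∣ * i         ≡⟨ trans (*-comm _ i) (cong (λ z → i * ∣ z - suc n ∣) (*-comm W B)) ⟩
      i * ∣ B * W - suc n ∣         <⟨ close ⟩
      B * suc n                     ≡⟨ trans (*-comm B (suc n)) (sym (*-identityˡ _)) ⟩
      1 * (suc n * B)               ∎
      where open ≤-Reasoning

  module Cover (b₀ : ℕ) (k : ℕ → ℕ) (M₀ : ℕ) where

    b M : ℕ
    b = suc (suc b₀)
    M = suc M₀

    -- The i-th block x ↾ [b ^ k i, …) starts at index b ^ k i ∸ 1 of the 0-indexed Digits.
    offset : ℕ → ℕ
    offset i = b ^ k i ∸ 1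

    μ : List (Fin b) → ℚ
    μ u = cylMass b (length u)

    deviantPrefixes : ℕ → ℕ → List (Fin b) → List (List (Fin b))
    deviantPrefixes i t w = filter (λ u → deviates? (2 * i) (checkpoint i t) w (drop (offset i) u)) (words (offset i + checkpoint i t))

    piece : ℕ → ℕ → List (List (Fin b))
    piece i t = concatMap (λ j → concatMap (deviantPrefixes i t) (words j)) (applyUpTo suc i)

    weight : ℕ → ℕ
    weight t = 2 * (suc t * suc (suc t))

    -- Only there to make every stage nonempty.
    filler : ℕ → List (Fin b)
    filler t = replicate (weight t * M) Fin.zero

    pieces : ℕ → List (List (Fin b))
    pieces t = concatMap (λ i → piece i t) (applyUpTo (M +_) (suc t))

    open Enumeration filler pieces public

    length-deviantPrefixes : ∀ i t w → length (deviantPrefixes i t w) ≡ b ^ offset i * length (filter (deviates? (2 * i) (checkpoint i t) w) (words (checkpoint i t)))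
    length-deviantPrefixes i t w = begin
      length (deviantPrefixes i t w)
        ≡⟨ length-filter≡∑ _ (words (offset i + N)) ⟩
      ∑[ u ∈ words (offset i + N) ] 𝟙 (does (deviates? (2 * i) N w (drop (offset i) u)))
        ≡⟨ ∑-words-drop (offset i) N (λ s → 𝟙 (does (deviates? (2 * i) N w s))) ⟩
      b ^ offset i * ∑[ s ∈ words N ] 𝟙 (does (deviates? (2 * i) N w s))
        ≡⟨ cong (b ^ offset i *_) (length-filter≡∑ (deviates? (2 * i) N w) (words N)) ⟨
      b ^ offset i * length (filter (deviates? (2 * i) N w) (words N)) ∎
      where
      open ≡-Reasoning
      N = checkpoint i t

    count-piece : ∀ i t → length (piece i t) * checkpoint i t ≤ i * (3 * i * (2 * i * (2 * i)) * b ^ (offset i + checkpoint i t))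
    count-piece i t = begin
      length (piece i t) * N
        ≡⟨ trans (cong (_* N) (length-concatMap _ (applyUpTo suc i))) (∑-*ʳ (applyUpTo suc i) _ N) ⟩
      ∑[ j ∈ applyUpTo suc i ] (length (concatMap (deviantPrefixes i t) (words j)) * N)
        ≤⟨ ∑-mono-≤ (applyUpTo suc i) (λ j∈ → per-length _ (1≤j j∈) (j≤i j∈)) ⟩
      ∑[ j ∈ applyUpTo suc i ] C i
        ≡⟨ trans (∑-const (applyUpTo suc i) (C i)) (cong (_* C i) (length-applyUpTo suc i)) ⟩
      i * C i ∎
      where
      open ≤-Reasoning
      N = checkpoint i t
      m = 2 * i
      L = offset i + N
      C : ℕ → ℕ
      C j = 3 * j * (m * m) * b ^ L
      1≤j : ∀ {j} → j ∈ applyUpTo suc i → 1 ≤ j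
      1≤j j∈ with _ , _ , refl ← ∈-applyUpTo⁻ suc j∈ = s≤s z≤n
      j≤i : ∀ {j} → j ∈ applyUpTo suc i → j ≤ i
      j≤i j∈ with _ , r<i , refl ← ∈-applyUpTo⁻ suc j∈ = r<i
      C-mono : ∀ {j} → j ≤ i → C j ≤ C i
      C-mono j≤i = *-monoˡ-≤ (b ^ L) (*-monoˡ-≤ (m * m) (*-monoʳ-≤ 3 j≤i))
      per-word : ∀ j w → length w ≡ j → 1 ≤ j → j ≤ i → b ^ j * (length (deviantPrefixes i t w) * N) ≤ C i
      per-word _ w refl 1≤j j≤i = begin
        b ^ j * (length (deviantPrefixes i t w) * N)   ≡⟨ cong (λ x → b ^ j * (x * N)) (length-deviantPrefixes i t w) ⟩
        b ^ j * (b ^ offset i * D * N)                 ≡⟨ reorder (b ^ j) (b ^ offset i) D N ⟩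
        b ^ offset i * (D * (b ^ j * N))               ≤⟨ *-monoʳ-≤ (b ^ offset i) (deviant-count w m N 1≤j (≤-trans j≤i (i≤checkpoint i t))) ⟩
        b ^ offset i * (3 * j * (m * m) * b ^ N)       ≡⟨ reorder′ (b ^ offset i) (3 * j * (m * m)) (b ^ N) ⟩
        3 * j * (m * m) * (b ^ offset i * b ^ N)       ≡⟨ cong (3 * j * (m * m) *_) (^-distribˡ-+-* b (offset i) N) ⟨
        C j                                            ≤⟨ C-mono j≤i ⟩
        C i                                            ∎
        where
        j = length w
        D = length (filter (deviates? m N w) (words N))
        reorder : ∀ x y d n → x * (y * d * n) ≡ y * (d * (x * n))
        reorder = solve-∀
        reorder′ : ∀ x c y → x * (c * y) ≡ c * (x * y)
        reorder′ = solve-∀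
      per-length : ∀ j → 1 ≤ j → j ≤ i → length (concatMap (deviantPrefixes i t) (words j)) * N ≤ C i
      per-length j 1≤j j≤i = *-cancelˡ-≤ (b ^ j) {{m^n≢0 b j}} (begin
        b ^ j * (length (concatMap (deviantPrefixes i t) (words j)) * N)
          ≡⟨ cong (b ^ j *_) (trans (cong (_* N) (length-concatMap _ (words j))) (∑-*ʳ (words j) _ N)) ⟩
        b ^ j * ∑[ w ∈ words j ] (length (deviantPrefixes i t w) * N)
          ≡⟨ ∑-*ˡ (words j) (b ^ j) _ ⟨
        ∑[ w ∈ words j ] (b ^ j * (length (deviantPrefixes i t w) * N))
          ≤⟨ ∑-mono-≤ (words j) (λ {w} w∈ → per-word j w (words-length w∈) 1≤j j≤i) ⟩
        ∑[ w ∈ words j ] C i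
          ≡⟨ ∑-words-const j (C i) ⟩
        b ^ j * C i ∎)

    piece-length : ∀ {i t u} → u ∈ piece i t → length u ≡ offset i + checkpoint i t
    piece-length {i} {t} u∈ with j , u∈j ← satisfied (∈-concatMap⁻ _ {xs = applyUpTo suc i} u∈)
                           with w , u∈w ← satisfied (∈-concatMap⁻ _ {xs = words j} u∈j) = words-length (proj₁ (∈-filter⁻ _ u∈w))

    μ-nonneg : ∀ u → 0ℚ ℚ.≤ μ u
    μ-nonneg u = 0≤÷ 1 (b ^ length u) {{m^n≢0 b (length u)}}

    piece-small : ∀ i t → 1 ≤ i → length (piece i t) * (weight t * i * suc i) ≤ 1 * b ^ (offset i + checkpoint i t)
    piece-small i t 1≤i = *-cancelʳ-≤ _ _ (12 * i ^ 4) {{i⁴≢0}} (begin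
      length (piece i t) * (weight t * i * suc i) * (12 * i ^ 4)   ≡⟨ *-assoc (length (piece i t)) _ _ ⟩
      length (piece i t) * (weight t * i * suc i * (12 * i ^ 4))   ≤⟨ *-monoʳ-≤ (length (piece i t)) (piece-weight i t 1≤i) ⟩
      length (piece i t) * checkpoint i t                         ≤⟨ count-piece i t ⟩
      i * (3 * i * (2 * i * (2 * i)) * b ^ L)                     ≡⟨ collect i (b ^ L) ⟩
      1 * b ^ L * (12 * i ^ 4)                                    ∎)
      where
      open ≤-Reasoning
      L = offset i + checkpoint i t
      i⁴≢0 : NonZero (12 * i ^ 4)
      i⁴≢0 = m*n≢0 12 (i ^ 4) {{_}} {{m^n≢0 i 4 {{>-nonZero 1≤i}}}}
      collect : ∀ i B → i * (3 * i * (2 * i * (2 * i)) * B) ≡ 1 * B * (12 * (i * (i * (i * (i * 1)))))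
      collect = solve-∀

    mass-piece : ∀ i t → ∑ℚ (piece (suc i) t) μ ℚ.≤ 1 ÷ (weight t * suc i * suc (suc i))
    mass-piece i t = begin
      ∑ℚ (piece (suc i) t) μ                              ≡⟨ ∑ℚ-cong-∈ (piece (suc i) t) (λ u∈ → cong (recipPow b) (piece-length {suc i} {t} u∈)) ⟩
      ∑ℚ (piece (suc i) t) (λ _ → _÷_ 1 (b ^ L) {{m^n≢0 b L}}) ≡⟨ ∑ℚ-const (piece (suc i) t) (b ^ L) {{m^n≢0 b L}} ⟩
      _÷_ (length (piece (suc i) t)) (b ^ L) {{m^n≢0 b L}} ≤⟨ ÷-≤ (length (piece (suc i) t)) 1 (b ^ L) _ {{m^n≢0 b L}} (piece-small (suc i) t (s≤s z≤n)) ⟩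
      1 ÷ (weight t * suc i * suc (suc i))                ∎
      where
      open ℚ.≤-Reasoning
      L = offset (suc i) + checkpoint (suc i) t

    mass-pieces : ∀ t → ∑ℚ (pieces t) μ ℚ.≤ 1 ÷ (weight t * M)
    mass-pieces t = begin
      ∑ℚ (pieces t) μ                                                  ≡⟨ ∑ℚ-concatMap (λ i → piece i t) (applyUpTo (M +_) (suc t)) μ ⟩
      ∑ℚ (applyUpTo (M +_) (suc t)) (λ i → ∑ℚ (piece i t) μ)          ≡⟨ ∑ℚ-applyUpTo (M +_) (suc t) (λ i → ∑ℚ (piece i t) μ) ⟩
      sumUpTo (λ r → ∑ℚ (piece (M + r) t) μ) (suc t)                   ≤⟨ sumUpTo-mono-≤ (suc t) (λ r → mass-piece (M₀ + r) t) ⟩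
      sumUpTo (λ r → 1 ÷ (weight t * (M + r) * suc (M + r))) (suc t)   ≤⟨ telescope-≤ (pred (weight t)) M₀ (suc t) ⟩
      1 ÷ (weight t * M)                                               ∎
      where open ℚ.≤-Reasoning

    mass-filler : ∀ t → μ (filler t) ℚ.≤ 1 ÷ (weight t * M)
    mass-filler t = ÷-≤ 1 1 (b ^ length (filler t)) (weight t * M) {{m^n≢0 b (length (filler t))}}
      (*-monoʳ-≤ 1 (subst (λ l → weight t * M ≤ b ^ l) (sym (length-replicate (weight t * M))) (n≤m^n b (s≤s (s≤s z≤n)) (weight t * M))))

    mass-stage : ∀ t → ∑ℚ (stage t) μ ℚ.≤ 1 ÷ (M * suc t * suc (suc t))
    mass-stage t = begin
      μ (filler t) ℚ.+ ∑ℚ (pieces t) μ                    ≤⟨ ℚ.+-mono-≤ (mass-filler t) (mass-pieces t) ⟩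
      1 ÷ (weight t * M) ℚ.+ 1 ÷ (weight t * M)           ≡⟨ ÷-+ 1 1 (weight t * M) (weight t * M) ⟩
      (1 * (weight t * M) + 1 * (weight t * M)) ÷ (weight t * M * (weight t * M))
        ≡⟨ ÷-cong (1 * (weight t * M) + 1 * (weight t * M)) 1 (weight t * M * (weight t * M)) (M * suc t * suc (suc t)) (halve M t) ⟩
      1 ÷ (M * suc t * suc (suc t))                       ∎
      where
      open ℚ.≤-Reasoning
      halve : ∀ M t → (1 * (2 * (suc t * suc (suc t)) * M) + 1 * (2 * (suc t * suc (suc t)) * M)) * (M * suc t * suc (suc t))
                      ≡ 1 * (2 * (suc t * suc (suc t)) * M * (2 * (suc t * suc (suc t)) * M))
      halve = solve-∀

    mass-cover : ∀ N → sumUpTo (μ ∘ enumerate) N ℚ.≤ 1 ÷ M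
    mass-cover N = begin
      sumUpTo (μ ∘ enumerate) N                              ≤⟨ sumUpTo-enumerate μ μ-nonneg N ⟩
      sumUpTo (λ t → ∑ℚ (stage t) μ) N                       ≤⟨ sumUpTo-mono-≤ N mass-stage ⟩
      sumUpTo (λ t → 1 ÷ (M * suc t * suc (suc t))) N        ≤⟨ telescope-≤ M₀ 0 N ⟩
      1 ÷ (M * 1)                                            ≡⟨ ÷-cong 1 1 (M * 1) M (cong (1 *_) (sym (*-identityʳ M))) ⟩
      1 ÷ M                                                  ∎
      where open ℚ.≤-Reasoning

    Uncovered : Digits b → Set
    Uncovered x = ∀ n → ¬ InCyl (enumerate n) x

    close-at-checkpoint : ∀ x → Uncovered x → ∀ i t (w : List (Fin b)) → M ≤ i → i ≤ t → 1 ≤ length w → length w ≤ i →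
      2 * i * ∣ b ^ length w * W (segment x (offset i) (checkpoint i t)) w - checkpoint i t ∣ < b ^ length w * checkpoint i t
    close-at-checkpoint x uncovered i t (d ∷ w′) M≤i i≤t _ j≤i = ≰⇒> λ deviant →
      let n , enumerate-n≡U = enumerate-complete t (there (U∈pieces deviant)) in
      uncovered n (subst (λ u → InCyl u x) (sym enumerate-n≡U) U-cylinder)
      where
      w = d ∷ w′
      N = checkpoint i t
      L = offset i + N
      U : List (Fin b)
      U = segment x 0 L
      U-cylinder : InCyl U x
      U-cylinder = trans (cong (restrict x 1) (length-applyUpTo _ L)) (restrict-segment x 0 L)
      U∈pieces : Deviates (2 * i) N w (segment x (offset i) N) → U ∈ pieces t
      U∈pieces deviant = ∈-concatMap-intro (λ i → piece i t) i∈ (∈-concatMap-intro _ j∈ (∈-concatMap-intro _ (∈-words w)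
        (∈-filter⁺ _ (subst (λ l → U ∈ words l) (length-applyUpTo _ L) (∈-words U))
                     (subst (Deviates (2 * i) N w) (sym (drop-applyUpTo _ (offset i) N)) deviant))))
        where
        j∈ : length w ∈ applyUpTo suc i
        j∈ = ∈-applyUpTo⁺ suc j≤i
        i∈ : i ∈ applyUpTo (M +_) (suc t)
        i∈ = subst (_∈ applyUpTo (M +_) (suc t)) (m+[n∸m]≡n M≤i) (∈-applyUpTo⁺ (M +_) (s≤s (≤-trans (m∸n≤m i M) i≤t)))

    close-between : ∀ x → Uncovered x → ∀ (w : List (Fin b)) → 1 ≤ length w → ∀ i t δ → M + length w ≤ i → startIndex i ≤ t →
      checkpoint i t + δ < checkpoint i (suc t) →
      i * ∣ b ^ length w * W (segment x (offset i) (checkpoint i t + δ)) w - (checkpoint i t + δ) ∣ < b ^ length w * (checkpoint i t + δ)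
    close-between x uncovered w 1≤j i t δ M+j≤i startIndex≤t n<N′ =
      subst (λ s → i * ∣ b ^ j * W s w - (N + δ) ∣ < b ^ j * (N + δ)) (sym (applyUpTo-++ (λ s → x (offset i + s)) N δ))
        (interpolation (b ^ j) i N δ W₀ W₁ j (m^n>0 b j) close₀ (W-++-≥ w head tail)
          (≤-trans (W-++-≤ w head tail 1≤j) (≤-reflexive (cong (W₀ + j +_) (length-applyUpTo (λ s → x (offset i + (N + s))) δ))))
          (checkpoint-gap i t j δ startIndex≤t n<N′ j≤i))
      where
      j = length w
      N = checkpoint i t
      M≤i : M ≤ i
      M≤i = m+n≤o⇒m≤o M M+j≤i
      j≤i : j ≤ i
      j≤i = m+n≤o⇒n≤o M M+j≤i
      head tail : List (Fin b)
      head = segment x (offset i) N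
      tail = applyUpTo (λ s → x (offset i + (N + s))) δ
      W₀ W₁ : ℕ
      W₀ = W head w
      W₁ = W (head ++ tail) w
      close₀ : 2 * i * ∣ b ^ j * W₀ - N ∣ < b ^ j * N
      close₀ = close-at-checkpoint x uncovered i t w M≤i (≤-trans (≤-trans (n≤1+n i) (m≤n*m (suc i) 8)) startIndex≤t) 1≤j j≤i

    close-on-blocks : ∀ x → Uncovered x → ∀ (w : List (Fin b)) → 1 ≤ length w → ∀ i → M + length w ≤ i → ∀ n → threshold i < n →
      i * ∣ b ^ length w * W (segment x (offset i) n) w - n ∣ < b ^ length w * n
    close-on-blocks x uncovered w 1≤j i M+j≤i n threshold<n =
      let t , startIndex≤t , N≤n , n<N′ = bracket (checkpoint i) (λ t → t≤checkpoint i t (≤-trans (s≤s z≤n) (m+n≤o⇒m≤o M M+j≤i))) (startIndex i) n (<⇒≤ threshold<n)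
      in subst (λ m → i * ∣ b ^ length w * W (segment x (offset i) m) w - m ∣ < b ^ length w * m) (m+[n∸m]≡n N≤n)
           (close-between x uncovered w 1≤j i t (n ∸ checkpoint i t) M+j≤i startIndex≤t
             (subst (_< checkpoint i (suc t)) (sym (m+[n∸m]≡n N≤n)) n<N′))

    eventually-close : ∀ x → Uncovered x → ∀ j → 1 ≤ j → (w : Vec (Fin b) j) → ∀ m →
      ∃ λ I → ∀ i → I ≤ i → ∀ n → threshold i < n → ℚ.∣ frac (W (restrict x (b ^ k i) n) (toList w)) n ℚ.- recipPow b j ∣ ℚ.< 1 ÷ suc m
    eventually-close x uncovered j 1≤j w m = M + j + suc m , λ i I≤i n threshold<n →
      subst (λ s → ℚ.∣ frac (W s (toList w)) n ℚ.- recipPow b j ∣ ℚ.< 1 ÷ suc m) (sym (restrict-block i n))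
        (close⇒frac (suc b₀) (W (segment x (offset i) n) (toList w)) n j m i (m+n≤o⇒n≤o (M + j) I≤i)
          (subst (λ l → i * ∣ b ^ l * W (segment x (offset i) n) (toList w) - n ∣ < b ^ l * n) (length-toList w)
            (close-on-blocks x uncovered (toList w) (≤-trans 1≤j (≤-reflexive (sym (length-toList w)))) i
              (≤-trans (≤-reflexive (cong (M +_) (length-toList w))) (m+n≤o⇒m≤o (M + j) I≤i)) n threshold<n)))
      where
      restrict-block : ∀ i n → restrict x (b ^ k i) n ≡ segment x (offset i) n
      restrict-block i n = trans (cong (λ a → restrict x a n) (sym (m+[n∸m]≡n (m^n>0 b (k i))))) (restrict-segment x (offset i) n)

-- The statement's imports come last: with ℚ's ∣_∣ and _-_ in scope, ℕ's ∣_-_∣ above would not parse.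
open import Data.Nat using (ℕ; zero; suc; _+_; _^_; _≤_; _<_; s≤s)
open import Data.Fin using (Fin)
open import Data.Vec using (Vec; toList)
open import Data.Rational using (ℚ; 0ℚ; _-_; ∣_∣)
open import Data.Product using (Σ; _×_; _,_)
import Data.Rational
import Data.Rational.Properties as ℚ

mainTheorem8 : (b : ℕ) → 2 ≤ b →
    Σ (ℕ → ℕ) λ g →
      (k : ℕ → ℕ) →
      ((i : ℕ) → k i < k (suc i)) →
      ((i : ℕ) → g i + b ^ k i < b ^ k (suc i)) →
      AlmostEvery b λ x →
        NonTerminating x →
        (j : ℕ) → 1 ≤ j → (w : Vec (Fin b) j) →
        (ε : ℚ) → Data.Rational._<_ 0ℚ ε →
        Σ ℕ λ I → (i : ℕ) → I ≤ i → (n : ℕ) → g i < n →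
          Data.Rational._<_
            ∣ frac (W (restrict x (b ^ k i) n) (toList w)) n - recipPow b j ∣
            ε
mainTheorem8 (suc zero) (s≤s ())
mainTheorem8 (suc (suc b₀)) _ = threshold , λ k _ _ ε ε>0 →
  let M₀ , 1/M≤ε = ∃1÷suc≤ ε ε>0
      open Cover b₀ k M₀
  in enumerate , (λ N → ℚ.≤-trans (mass-cover N) 1/M≤ε) , λ x uncovered _ j 1≤j w ε′ ε′>0 →
       let m , 1/m≤ε′ = ∃1÷suc≤ ε′ ε′>0
           I , close = eventually-close x uncovered j 1≤j w m
       in I , λ i I≤i n threshold<n → ℚ.<-≤-trans (close i I≤i n threshold<n) 1/m≤ε′
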